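{- Let $1\le k\le n$ and $q_2\in[0,1]$, and for $\sigma\in\mathfrak S_n$ let $\theta(\sigma)\in\mathfrak S_k$ be the standardisation of its last $k$ letters $(\sigma_{n-k+1}\cdots\sigma_n)$. Then the top-to-random-with-standardisation chain on $\mathfrak S_n$ lumps via $\theta$ to the $\frac{n-k}{n}$-lazy version of the top-to-random-with-standardisation chain on $\mathfrak S_k$, and the binomial-top-to-random-with-standardisation chain on $\mathfrak S_n$ with parameter $q_2$ lumps via $\theta$ to the binomial-top-to-random-with-standardisation chain on $\mathfrak S_k$ with the same parameter $q_2$.
   Context: Standardisation of a string of distinct numbers replaces its letters by $1,2,\dots$ preserving relative order. Top-to-random-with-standardisation chain on $\mathfrak S_m$: from $\sigma$ (one-line notation), remove the first letter, replace the remaining letters by $2,\dots,m$ preserving relative order, and insert the letter $1$ in one of the $m$ positions chosen uniformly. Binomial-top-to-random-with-standardisation chain with parameter $q_2$: choose $r\sim\mathrm{Binomial}(m,1-q_2)$, remove the first $r$ letters, replace the remaining letters by $r+1,\dots,m$ preserving relative order, and insert the letters $1,\dots,r$ so that the result is uniform among the $m!/(m-r)!$ permutations in $\mathfrak S_m$ in which the letters $r+1,\dots,m$ appear in that relative order. The $\alpha$-lazy version of a chain with transition matrix $K$ has transition matrix $\alpha\,\mathrm{id}+(1-\alpha)K$. A chain $\{X_t\}$ lumps via a surjection $\theta$ to $\{\bar X_t\}$ if $\{\theta(X_t)\}$ is a Markov chain with the same transition matrix as $\{\bar X_t\}$.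
   Formalization: The parameter $q_2$ ranges over the rationals in [0,1], and the lumping condition is required only for initial distributions on 𝔖ₙ with rational values. -}

module Defs where

open import Data.Nat as ℕ using (ℕ; zero; suc; _∸_)
open import Data.Nat.Combinatorics using (_C_; _P_)
open import Data.List using (List; []; _∷_; map; filter; length; drop; take; concatMap; upTo; _++_)
open import Data.List.Properties using (≡-dec)
open import Data.List.Relation.Unary.All using (All)
open import Data.List.Membership.Propositional using (_∈_)
open import Data.Integer using (+_)
open import Data.Rational using (ℚ; 0ℚ; 1ℚ; _+_; _*_; _-_; _/_; _≤_)
open import Data.Product using (_×_; Σ-syntax)
open import Relation.Binary.PropositionalEquality using (_≡_)
open import Relation.Nullary using (yes; no)

-- Permutations in one-line notation: a permutation of 𝔖ₘ is the list
-- [σ₁, …, σₘ] of the values 1 … m.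

insertAt : ℕ → ℕ → List ℕ → List ℕ
insertAt x zero    w        = x ∷ w
insertAt x (suc i) []       = x ∷ []
insertAt x (suc i) (y ∷ w)  = y ∷ insertAt x i w

perms : ℕ → List (List ℕ)
perms zero    = [] ∷ []
perms (suc m) = concatMap (λ p → map (λ i → insertAt (suc m) i p) (upTo (suc m))) (perms m)

rank : ℕ → List ℕ → ℕ
rank x w = length (filter (λ y → y ℕ.<? x) w)

stdFrom : ℕ → List ℕ → List ℕ
stdFrom off w = map (λ x → off ℕ.+ suc (rank x w)) w

std : List ℕ → List ℕ
std = stdFrom 0

theta : ℕ → ℕ → List ℕ → List ℕ
theta n k σ = std (drop (n ∸ k) σ)

ind : (x y : List ℕ) → ℚ
ind x y with ≡-dec ℕ._≟_ x y
... | yes _ = 1ℚ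
... | no  _ = 0ℚ

fromℕ : ℕ → ℚ
fromℕ n = + n / 1

-- 1/n for n ≥ 1 (and 0 for n = 0; never used with n = 0)
inv : ℕ → ℚ
inv zero    = 0ℚ
inv (suc n) = + 1 / suc n

pow : ℚ → ℕ → ℚ
pow q zero    = 1ℚ
pow q (suc n) = q * pow q n

sumL : {A : Set} → List A → (A → ℚ) → ℚ
sumL []       f = 0ℚ
sumL (x ∷ xs) f = f x + sumL xs f

-- Transition matrices (K σ τ = probability of moving from σ to τ)

t2r : ℕ → List ℕ → List ℕ → ℚ
t2r m σ τ = inv m * sumL (upTo m) (λ i → ind (insertAt 1 i (stdFrom 1 (drop 1 σ))) τ)

idK : List ℕ → List ℕ → ℚ
idK = ind

lazy : ℚ → (List ℕ → List ℕ → ℚ) → List ℕ → List ℕ → ℚ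
lazy α K σ τ = α * idK σ τ + (1ℚ - α) * K σ τ

-- binomial-top-to-random-with-standardisation on 𝔖ₘ with parameter q₂:
-- r ~ Bin(m, 1 - q₂); remove the first r letters, standardise the rest to
-- r+1,…,m, and the result is uniform among the m!/(m-r)! permutations of
-- 𝔖ₘ in which r+1,…,m appear in that relative order.
b2r : ℕ → ℚ → List ℕ → List ℕ → ℚ
b2r m q σ τ = sumL (upTo (suc m)) λ r →
  fromℕ (m C r) * pow (1ℚ - q) r * pow q (m ∸ r)
  * inv (m P r)
  * ind (filter (λ x → r ℕ.<? x) τ) (stdFrom r (drop r σ))

-- A chain with state space S (enumerated list) and matrix K
-- lumps via θ to the chain with state space S' and matrix K' if θ is a
-- surjection S → S' and, for every initial distribution μ on S, the
-- process θ(X_t) is a Markov chain with transition matrix K', i.e. for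
-- all t and y₀,…,y_t ∈ S':
--   P(θX₀ = y₀, …, θX_t = y_t) = P(θX₀ = y₀) · ∏ K'(y_{i-1}, y_i).

-- f ↦ (x' ↦ [θ x' = y] Σ_x f x K x x'), forward propagation of
-- P(θX₀=y₀,…,θX_t=y_t, X_t = x)
step : List (List ℕ) → (List ℕ → List ℕ → ℚ) → (List ℕ → List ℕ) →
       (List ℕ → ℚ) → List ℕ → (List ℕ → ℚ)
step S K θ f y x' = ind (θ x') y * sumL S (λ x → f x * K x x')

pathW : List (List ℕ) → (List ℕ → List ℕ → ℚ) → (List ℕ → List ℕ) →
        (List ℕ → ℚ) → List (List ℕ) → (List ℕ → ℚ)
pathW S K θ f []       = f
pathW S K θ f (y ∷ ys) = pathW S K θ (step S K θ f y) ys

-- P(θX₀ = y₀, …, θX_t = y_t) where ys = y₁ … y_t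
probLumped : List (List ℕ) → (List ℕ → List ℕ → ℚ) → (List ℕ → List ℕ) →
             (List ℕ → ℚ) → List ℕ → List (List ℕ) → ℚ
probLumped S K θ μ y₀ ys =
  sumL S (pathW S K θ (λ x → ind (θ x) y₀ * μ x) ys)

prodPath : (List ℕ → List ℕ → ℚ) → List ℕ → List (List ℕ) → ℚ
prodPath K' y []       = 1ℚ
prodPath K' y (y' ∷ ys) = K' y y' * prodPath K' y' ys

IsDistribution : List (List ℕ) → (List ℕ → ℚ) → Set
IsDistribution S μ = All (λ x → 0ℚ ≤ μ x) S × sumL S μ ≡ 1ℚ

Lumps : List (List ℕ) → (List ℕ → List ℕ → ℚ) →
        List (List ℕ) → (List ℕ → List ℕ → ℚ) → (List ℕ → List ℕ) → Set
Lumps S K S' K' θ =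
  All (λ x → θ x ∈ S') S ×
  All (λ y → Σ[ x ∈ List ℕ ] (x ∈ S × θ x ≡ y)) S' ×
  ((μ : List ℕ → ℚ) → IsDistribution S μ →
   (y₀ : List ℕ) (ys : List (List ℕ)) → y₀ ∈ S' → All (_∈ S') ys →
   probLumped S K θ μ y₀ ys
     ≡ sumL S (λ x → ind (θ x) y₀ * μ x) * prodPath K' y₀ ys)

-- Both lumpings are instances of Dynkin's criterion: if, for every state σ and every τ′ ∈ 𝔖ₖ, the
-- probability of jumping from σ into the fibre θ⁻¹(τ′) equals K′(θ σ, τ′), then θ(X_t) is a Markov
-- chain with kernel K′, for every initial distribution.
--
-- A top-to-random step from σ ∈ 𝔖ₙ inserts 1 at a uniform position i of the standardised tail of σ.
-- For the n − k positions i < n − k the last k letters keep their relative order, so θ does not move;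
-- for i = n − k + j the new θ is θ σ with 1 inserted at position j of its standardised tail, i.e. a
-- uniform top-to-random step on 𝔖ₖ. Hence the (n − k)/n-lazy chain.
--
-- For the binomial chain, θ is an iterate of σ ↦ std(σ₂ ⋯ σₘ₊₁), so it suffices to lump 𝔖ₘ₊₁ to 𝔖ₘ
-- along this map and to compose. Its fibre over y consists of the m + 1 permutations obtained by putting
-- a letter a + 1 in front of y and raising the letters ≥ a + 1. Removing r letters from σ lands in the
-- fibre with the same outcome as removing r − 1 letters from std(σ₂ ⋯) for each of the r front letters
-- a < r, and with the outcome of removing r letters from std(σ₂ ⋯) for exactly one a ≥ r. The weights
-- wₘ(r) = C(m,r) (1−q)ʳ qᵐ⁻ʳ / P(m,r) = (1−q)ʳ qᵐ⁻ʳ / r! satisfy (s+1) wₘ₊₁(s+1) + wₘ₊₁(s) = wₘ(s),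
-- which regroups the resulting sum into the kernel of the chain on 𝔖ₘ.

module Submission where

open import Defs
open import Data.Nat using (ℕ; _≤_; _∸_)
open import Data.Rational using (ℚ; 0ℚ; 1ℚ; _*_)
open import Data.Rational as Q using ()
open import Data.Product using (_×_)
open import Data.Product using (_,_; Σ-syntax; proj₁; proj₂)

open import Data.Nat as ℕ using (zero; suc; _<_; s≤s; z≤n; pred; _!)
import Data.Nat.Properties as ℕP
import Data.Nat.Coprimality as Coprime
open import Data.Nat.Combinatorics using (_C_; _P_; nCk≡nPk/k!)
open import Data.Nat.Combinatorics.Base using (_P′_)
open import Data.Nat.Combinatorics.Specification using (k!∣nP′k; nPk≡n!/[n∸k]!; nP′k≡n!/[n∸k]!)
open import Data.Nat.DivMod using (m/n*n≡m)
open import Data.Nat.Divisibility using (_∣_)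
import Data.Integer as ℤ
import Data.Integer.Properties as ℤP
open import Data.Rational using (_+_; _-_; mkℚ)
import Data.Rational.Properties as ℚP
open import Data.Rational.Solver using (module +-*-Solver)
open import Data.List using (List; []; _∷_; map; filter; length; drop; concatMap; upTo; applyUpTo; _++_)
import Data.List.Properties as LP
open import Data.List.Properties using (≡-dec)
open import Data.List.Membership.Propositional using (_∈_; _∉_)
open import Data.List.Relation.Unary.Any using (here; there)
open import Data.List.Relation.Unary.All as All using (All; []; _∷_)
import Data.List.Relation.Unary.All.Properties as AllP
open import Data.List.Relation.Unary.Unique.Propositional using (Unique; []; _∷_)
import Data.List.Relation.Unary.Unique.Propositional.Properties as UniqueP
open import Data.List.Membership.Propositional.Properties using (∈-∃++; ∈-++⁺ˡ)
import Data.List.Membership.DecPropositional as DecMembership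
open import Data.List.Relation.Binary.Permutation.Propositional
  using (_↭_; ↭-refl; ↭-sym; ↭-trans; ↭-prep; ↭-swap; ↭⇒↭ₛ)
import Data.List.Relation.Binary.Permutation.Propositional.Properties as PermP
import Data.List.Relation.Binary.Permutation.Setoid.Properties as PermSetoidP
open import Data.Empty using (⊥-elim)
open import Function using (_∘_)
open import Relation.Binary using (tri<; tri≈; tri>; _Preserves_⟶_)
open import Data.Sum using (inj₁; inj₂)
open import Relation.Binary.PropositionalEquality
open import Relation.Nullary using (yes; no; ¬_; Dec)

open +-*-Solver

fromℕ≡mkℚ : ∀ n → fromℕ n ≡ mkℚ (ℤ.+ n) 0 (Coprime.sym (Coprime.1-coprimeTo n))
fromℕ≡mkℚ n = ℚP.↥p/↧p≡p (mkℚ (ℤ.+ n) 0 (Coprime.sym (Coprime.1-coprimeTo n)))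

fromℕ-+ : ∀ a b → fromℕ (a ℕ.+ b) ≡ fromℕ a + fromℕ b
fromℕ-+ a b = sym (trans (cong₂ _+_ (fromℕ≡mkℚ a) (fromℕ≡mkℚ b))
  (ℚP./-cong (cong₂ ℤ._+_ (ℤP.*-identityʳ (ℤ.+ a)) (ℤP.*-identityʳ (ℤ.+ b))) refl))

fromℕ-* : ∀ a b → fromℕ (a ℕ.* b) ≡ fromℕ a * fromℕ b
fromℕ-* a b = sym (trans (cong₂ _*_ (fromℕ≡mkℚ a) (fromℕ≡mkℚ b)) (ℚP./-cong (sym (ℤP.pos-* a b)) refl))

fromℕ*inv≡1 : ∀ n → fromℕ (suc n) * inv (suc n) ≡ 1ℚ
fromℕ*inv≡1 n = trans
  (cong₂ _*_ (fromℕ≡mkℚ (suc n)) (ℚP.↥p/↧p≡p (mkℚ (ℤ.+ 1) n (Coprime.1-coprimeTo (suc n)))))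
  (ℚP.*-inverseʳ (mkℚ (ℤ.+ suc n) 0 (Coprime.sym (Coprime.1-coprimeTo (suc n)))))

fromℕ*inv-cancelˡ : ∀ a b c → a ℕ.* b ≡ c → 0 < b → 0 < c → fromℕ a * inv c ≡ inv b
fromℕ*inv-cancelˡ a (suc b) (suc c) ab≡c _ _ = begin
  X                                  ≡⟨ sym (ℚP.*-identityʳ X) ⟩
  X * 1ℚ                             ≡⟨ cong (X *_) (sym (fromℕ*inv≡1 b)) ⟩
  X * (fromℕ (suc b) * inv (suc b))  ≡⟨ sym (ℚP.*-assoc X _ _) ⟩
  X * fromℕ (suc b) * inv (suc b)    ≡⟨ cong (_* inv (suc b)) X*b≡1 ⟩
  1ℚ * inv (suc b)                   ≡⟨ ℚP.*-identityˡ _ ⟩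
  inv (suc b)                        ∎
  where
  open ≡-Reasoning
  X = fromℕ a * inv (suc c)
  X*b≡1 : X * fromℕ (suc b) ≡ 1ℚ
  X*b≡1 = begin
    fromℕ a * inv (suc c) * fromℕ (suc b)
      ≡⟨ solve 3 (λ x y z → x :* y :* z := x :* z :* y) refl (fromℕ a) (inv (suc c)) (fromℕ (suc b)) ⟩
    fromℕ a * fromℕ (suc b) * inv (suc c)  ≡⟨ cong (_* inv (suc c)) (sym (fromℕ-* a (suc b))) ⟩
    fromℕ (a ℕ.* suc b) * inv (suc c)      ≡⟨ cong (λ t → fromℕ t * inv (suc c)) ab≡c ⟩
    fromℕ (suc c) * inv (suc c)            ≡⟨ fromℕ*inv≡1 c ⟩
    1ℚ                                     ∎

module _ {A : Set} where

  sumL-cong-∈ : ∀ (xs : List A) {f g : A → ℚ} → (∀ x → x ∈ xs → f x ≡ g x) → sumL xs f ≡ sumL xs g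
  sumL-cong-∈ []       f≡g = refl
  sumL-cong-∈ (x ∷ xs) f≡g = cong₂ _+_ (f≡g x (here refl)) (sumL-cong-∈ xs (λ y y∈ → f≡g y (there y∈)))

  sumL-cong : ∀ (xs : List A) {f g : A → ℚ} → (∀ x → f x ≡ g x) → sumL xs f ≡ sumL xs g
  sumL-cong xs f≡g = sumL-cong-∈ xs (λ x _ → f≡g x)

  sumL-zero : ∀ (xs : List A) → sumL xs (λ _ → 0ℚ) ≡ 0ℚ
  sumL-zero []       = refl
  sumL-zero (x ∷ xs) = trans (ℚP.+-identityˡ _) (sumL-zero xs)

  sumL-+ : ∀ (xs : List A) (f g : A → ℚ) → sumL xs (λ x → f x + g x) ≡ sumL xs f + sumL xs g
  sumL-+ []       f g = refl
  sumL-+ (x ∷ xs) f g = trans (cong ((f x + g x) +_) (sumL-+ xs f g))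
    (solve 4 (λ a b c d → a :+ b :+ (c :+ d) := a :+ c :+ (b :+ d)) refl (f x) (g x) (sumL xs f) (sumL xs g))

  sumL-*ˡ : ∀ (xs : List A) (c : ℚ) (f : A → ℚ) → sumL xs (λ x → c * f x) ≡ c * sumL xs f
  sumL-*ˡ []       c f = sym (ℚP.*-zeroʳ c)
  sumL-*ˡ (x ∷ xs) c f = trans (cong (c * f x +_) (sumL-*ˡ xs c f)) (sym (ℚP.*-distribˡ-+ c (f x) (sumL xs f)))

  sumL-*ʳ : ∀ (xs : List A) (c : ℚ) (f : A → ℚ) → sumL xs (λ x → f x * c) ≡ sumL xs f * c
  sumL-*ʳ xs c f = trans (sumL-cong xs (λ x → ℚP.*-comm (f x) c)) (trans (sumL-*ˡ xs c f) (ℚP.*-comm c _))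

  sumL-++ : ∀ (xs ys : List A) (f : A → ℚ) → sumL (xs ++ ys) f ≡ sumL xs f + sumL ys f
  sumL-++ []       ys f = sym (ℚP.+-identityˡ _)
  sumL-++ (x ∷ xs) ys f = trans (cong (f x +_) (sumL-++ xs ys f)) (sym (ℚP.+-assoc (f x) _ _))

module _ {A B : Set} where

  sumL-comm : ∀ (xs : List A) (ys : List B) (f : A → B → ℚ) →
    sumL xs (λ x → sumL ys (f x)) ≡ sumL ys (λ y → sumL xs (λ x → f x y))
  sumL-comm []       ys f = sym (sumL-zero ys)
  sumL-comm (x ∷ xs) ys f = trans (cong (sumL ys (f x) +_) (sumL-comm xs ys f))
    (sym (sumL-+ ys (f x) (λ y → sumL xs (λ x' → f x' y))))

  sumL-map : ∀ (g : A → B) (xs : List A) (f : B → ℚ) → sumL (map g xs) f ≡ sumL xs (f ∘ g)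
  sumL-map g []       f = refl
  sumL-map g (x ∷ xs) f = cong (f (g x) +_) (sumL-map g xs f)

  sumL-concatMap : ∀ (g : A → List B) (xs : List A) (f : B → ℚ) →
    sumL (concatMap g xs) f ≡ sumL xs (λ x → sumL (g x) f)
  sumL-concatMap g []       f = refl
  sumL-concatMap g (x ∷ xs) f =
    trans (sumL-++ (g x) (concatMap g xs) f) (cong (sumL (g x) f +_) (sumL-concatMap g xs f))

sumL-applyUpTo : ∀ (g : ℕ → ℕ) n (f : ℕ → ℚ) → sumL (applyUpTo g n) f ≡ sumL (upTo n) (f ∘ g)
sumL-applyUpTo g zero    f = refl
sumL-applyUpTo g (suc n) f =
  cong (f (g 0) +_) (trans (sumL-applyUpTo (g ∘ suc) n f) (sym (sumL-applyUpTo suc n (f ∘ g))))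

sumL-upTo-suc : ∀ n (f : ℕ → ℚ) → sumL (upTo (suc n)) f ≡ f 0 + sumL (upTo n) (f ∘ suc)
sumL-upTo-suc n f = cong (f 0 +_) (sumL-applyUpTo suc n f)

sumL-upTo-cong : ∀ n {f g : ℕ → ℚ} → (∀ i → i < n → f i ≡ g i) → sumL (upTo n) f ≡ sumL (upTo n) g
sumL-upTo-cong zero    f≡g = refl
sumL-upTo-cong (suc n) {f} {g} f≡g = begin
  sumL (upTo (suc n)) f          ≡⟨ sumL-upTo-suc n f ⟩
  f 0 + sumL (upTo n) (f ∘ suc)  ≡⟨ cong₂ _+_ (f≡g 0 (s≤s z≤n)) (sumL-upTo-cong n (λ i i<n → f≡g (suc i) (s≤s i<n))) ⟩
  g 0 + sumL (upTo n) (g ∘ suc)  ≡⟨ sym (sumL-upTo-suc n g) ⟩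
  sumL (upTo (suc n)) g          ∎
  where open ≡-Reasoning

sumL-upTo-+ : ∀ a b (f : ℕ → ℚ) → sumL (upTo (a ℕ.+ b)) f ≡ sumL (upTo a) f + sumL (upTo b) (λ j → f (a ℕ.+ j))
sumL-upTo-+ zero    b f = sym (ℚP.+-identityˡ _)
sumL-upTo-+ (suc a) b f = begin
  sumL (upTo (suc a ℕ.+ b)) f
    ≡⟨ sumL-upTo-suc (a ℕ.+ b) f ⟩
  f 0 + sumL (upTo (a ℕ.+ b)) (f ∘ suc)
    ≡⟨ cong (f 0 +_) (sumL-upTo-+ a b (f ∘ suc)) ⟩
  f 0 + (sumL (upTo a) (f ∘ suc) + rest)
    ≡⟨ sym (ℚP.+-assoc (f 0) _ _) ⟩
  f 0 + sumL (upTo a) (f ∘ suc) + rest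
    ≡⟨ cong (_+ rest) (sym (sumL-upTo-suc a f)) ⟩
  sumL (upTo (suc a)) f + rest ∎
  where
  open ≡-Reasoning
  rest = sumL (upTo b) (λ j → f (suc a ℕ.+ j))

sumL-upTo-sucʳ : ∀ n (f : ℕ → ℚ) → sumL (upTo (suc n)) f ≡ sumL (upTo n) f + f n
sumL-upTo-sucʳ n f = trans (cong (λ m → sumL (upTo m) f) (ℕP.+-comm 1 n))
  (trans (sumL-upTo-+ n 1 f) (cong (sumL (upTo n) f +_) (trans (ℚP.+-identityʳ _) (cong f (ℕP.+-identityʳ n)))))

sumL-upTo-const : ∀ n (c : ℚ) → sumL (upTo n) (λ _ → c) ≡ fromℕ n * c
sumL-upTo-const zero    c = sym (ℚP.*-zeroˡ c)
sumL-upTo-const (suc n) c = begin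
  sumL (upTo (suc n)) (λ _ → c)  ≡⟨ sumL-upTo-suc n (λ _ → c) ⟩
  c + sumL (upTo n) (λ _ → c)    ≡⟨ cong (c +_) (sumL-upTo-const n c) ⟩
  c + fromℕ n * c                ≡⟨ solve 2 (λ c x → c :+ x :* c := (con 1ℚ :+ x) :* c) refl c (fromℕ n) ⟩
  (1ℚ + fromℕ n) * c             ≡⟨ cong (_* c) (sym (fromℕ-+ 1 n)) ⟩
  fromℕ (suc n) * c              ∎
  where open ≡-Reasoning

δ : ℕ → ℕ → ℚ
δ i j with i ℕ.≟ j
... | yes _ = 1ℚ
... | no  _ = 0ℚ

δ-refl : ∀ i → δ i i ≡ 1ℚ
δ-refl i with i ℕ.≟ i
... | yes _  = refl
... | no i≢i = ⊥-elim (i≢i refl)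

δ-≢ : ∀ {i j} → i ≢ j → δ i j ≡ 0ℚ
δ-≢ {i} {j} i≢j with i ℕ.≟ j
... | yes i≡j = ⊥-elim (i≢j i≡j)
... | no  _   = refl

δ-suc : ∀ i j → δ (suc i) (suc j) ≡ δ i j
δ-suc i j with i ℕ.≟ j
... | yes refl = δ-refl (suc i)
... | no  i≢j  = δ-≢ (i≢j ∘ ℕP.suc-injective)

sumL-upTo-δ : ∀ n j (f : ℕ → ℚ) → j < n → sumL (upTo n) (λ i → δ i j * f i) ≡ f j
sumL-upTo-δ (suc n) zero f _ = begin
  sumL (upTo (suc n)) (λ i → δ i 0 * f i)           ≡⟨ sumL-upTo-suc n (λ i → δ i 0 * f i) ⟩
  δ 0 0 * f 0 + sumL (upTo n) (λ i → δ (suc i) 0 * f (suc i))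
    ≡⟨ cong₂ _+_ (trans (cong (_* f 0) (δ-refl 0)) (ℚP.*-identityˡ (f 0)))
                 (trans (sumL-cong (upTo n) (λ i → trans (cong (_* f (suc i)) (δ-≢ {suc i} {0} (λ ()))) (ℚP.*-zeroˡ (f (suc i)))))
                        (sumL-zero (upTo n))) ⟩
  f 0 + 0ℚ                                           ≡⟨ ℚP.+-identityʳ _ ⟩
  f 0                                                ∎
  where open ≡-Reasoning
sumL-upTo-δ (suc n) (suc j) f (s≤s j<n) = begin
  sumL (upTo (suc n)) (λ i → δ i (suc j) * f i)     ≡⟨ sumL-upTo-suc n (λ i → δ i (suc j) * f i) ⟩
  δ 0 (suc j) * f 0 + sumL (upTo n) (λ i → δ (suc i) (suc j) * f (suc i))
    ≡⟨ cong₂ _+_ (trans (cong (_* f 0) (δ-≢ {0} {suc j} (λ ()))) (ℚP.*-zeroˡ (f 0)))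
                 (trans (sumL-cong (upTo n) (λ i → cong (_* f (suc i)) (δ-suc i j))) (sumL-upTo-δ n j (f ∘ suc) j<n)) ⟩
  0ℚ + f (suc j)                                     ≡⟨ ℚP.+-identityˡ _ ⟩
  f (suc j)                                          ∎
  where open ≡-Reasoning

ind-refl : ∀ x → ind x x ≡ 1ℚ
ind-refl x with ≡-dec ℕ._≟_ x x
... | yes _  = refl
... | no x≢x = ⊥-elim (x≢x refl)

ind-≢ : ∀ {x y} → x ≢ y → ind x y ≡ 0ℚ
ind-≢ {x} {y} x≢y with ≡-dec ℕ._≟_ x y
... | yes x≡y = ⊥-elim (x≢y x≡y)
... | no  _   = refl

ind-sym : ∀ x y → ind x y ≡ ind y x
ind-sym x y with ≡-dec ℕ._≟_ x y
... | yes refl = sym (ind-refl x)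
... | no  x≢y  = sym (ind-≢ (x≢y ∘ sym))

ind-∷ : ∀ a b xs ys → ind (a ∷ xs) (b ∷ ys) ≡ δ a b * ind xs ys
ind-∷ a b xs ys = by-cases (a ℕ.≟ b) (≡-dec ℕ._≟_ xs ys)
  where
  by-cases : Dec (a ≡ b) → Dec (xs ≡ ys) → ind (a ∷ xs) (b ∷ ys) ≡ δ a b * ind xs ys
  by-cases (yes refl) (yes refl) = trans (ind-refl (a ∷ xs)) (sym (cong₂ _*_ (δ-refl a) (ind-refl xs)))
  by-cases (yes refl) (no xs≢ys) = trans (ind-≢ {a ∷ xs} {a ∷ ys} (xs≢ys ∘ LP.∷-injectiveʳ))
                                     (sym (trans (cong (δ a a *_) (ind-≢ xs≢ys)) (ℚP.*-zeroʳ (δ a a))))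
  by-cases (no a≢b)   _          = trans (ind-≢ {a ∷ xs} {b ∷ ys} (a≢b ∘ LP.∷-injectiveˡ))
                                     (sym (trans (cong (_* ind xs ys) (δ-≢ a≢b)) (ℚP.*-zeroˡ (ind xs ys))))

ind-map : ∀ (f : ℕ → ℕ) → (∀ {a b} → f a ≡ f b → a ≡ b) → ∀ xs ys → ind (map f xs) (map f ys) ≡ ind xs ys
ind-map f f-inj xs ys with ≡-dec ℕ._≟_ xs ys
... | yes refl = ind-refl (map f xs)
... | no  xs≢ys = ind-≢ (xs≢ys ∘ LP.map-injective f-inj)

ind-*-subst : ∀ {x y} (g : List ℕ → ℚ) → ind x y * g x ≡ ind x y * g y
ind-*-subst {x} {y} g with ≡-dec ℕ._≟_ x y
... | yes refl = refl
... | no  _    = trans (ℚP.*-zeroˡ (g x)) (sym (ℚP.*-zeroˡ (g y)))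

-- Dynkin's criterion

Kernel : Set
Kernel = List ℕ → List ℕ → ℚ

DynkinCriterion : List (List ℕ) → Kernel → List (List ℕ) → Kernel → (List ℕ → List ℕ) → Set
DynkinCriterion S K S' K' θ = ∀ x → x ∈ S → ∀ y → y ∈ S' →
  sumL S (λ x' → ind (θ x') y * K x x') ≡ K' (θ x) y

module _ {S : List (List ℕ)} {K : Kernel} {S' : List (List ℕ)} {K' : Kernel} {θ : List ℕ → List ℕ}
         (dynkin : DynkinCriterion S K S' K' θ) where

  sumL-step : ∀ y₀ y (g : List ℕ → ℚ) → y ∈ S' →
    sumL S (step S K θ (λ x → ind (θ x) y₀ * g x) y) ≡ sumL S (λ x → ind (θ x) y₀ * g x) * K' y₀ y
  sumL-step y₀ y g y∈S' = begin
    sumL S (λ x' → ind (θ x') y * sumL S (λ x → f x * K x x'))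
      ≡⟨ sumL-cong S (λ x' → sym (sumL-*ˡ S (ind (θ x') y) (λ x → f x * K x x'))) ⟩
    sumL S (λ x' → sumL S (λ x → ind (θ x') y * (f x * K x x')))
      ≡⟨ sumL-comm S S (λ x' x → ind (θ x') y * (f x * K x x')) ⟩
    sumL S (λ x → sumL S (λ x' → ind (θ x') y * (f x * K x x')))
      ≡⟨ sumL-cong S (λ x → trans (sumL-cong S (λ x' → rearrange (ind (θ x') y) (f x) (K x x')))
                                  (sumL-*ˡ S (f x) (λ x' → ind (θ x') y * K x x'))) ⟩
    sumL S (λ x → f x * sumL S (λ x' → ind (θ x') y * K x x'))
      ≡⟨ sumL-cong-∈ S (λ x x∈S → cong (f x *_) (dynkin x x∈S y y∈S')) ⟩
    sumL S (λ x → f x * K' (θ x) y)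
      ≡⟨ sumL-cong S (λ x → trans (ℚP.*-assoc (ind (θ x) y₀) (g x) _)
                          (trans (ind-*-subst {θ x} {y₀} (λ z → g x * K' z y)) (sym (ℚP.*-assoc (ind (θ x) y₀) (g x) _)))) ⟩
    sumL S (λ x → f x * K' y₀ y)
      ≡⟨ sumL-*ʳ S (K' y₀ y) f ⟩
    sumL S f * K' y₀ y ∎
    where
    open ≡-Reasoning
    f = λ x → ind (θ x) y₀ * g x
    rearrange : ∀ a b c → a * (b * c) ≡ b * (a * c)
    rearrange = solve 3 (λ a b c → a :* (b :* c) := b :* (a :* c)) refl

  sumL-pathW : ∀ ys → All (_∈ S') ys → ∀ y₀ (g : List ℕ → ℚ) →
    sumL S (pathW S K θ (λ x → ind (θ x) y₀ * g x) ys) ≡ sumL S (λ x → ind (θ x) y₀ * g x) * prodPath K' y₀ ys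
  sumL-pathW []       []             y₀ g = sym (ℚP.*-identityʳ _)
  sumL-pathW (y ∷ ys) (y∈S' ∷ ys∈S') y₀ g = begin
    sumL S (pathW S K θ (λ x' → ind (θ x') y * sumL S (λ x → f x * K x x')) ys)
      ≡⟨ sumL-pathW ys ys∈S' y (λ x' → sumL S (λ x → f x * K x x')) ⟩
    sumL S (step S K θ f y) * prodPath K' y ys
      ≡⟨ cong (_* prodPath K' y ys) (sumL-step y₀ y g y∈S') ⟩
    sumL S f * K' y₀ y * prodPath K' y ys
      ≡⟨ ℚP.*-assoc (sumL S f) (K' y₀ y) (prodPath K' y ys) ⟩
    sumL S f * prodPath K' y₀ (y ∷ ys) ∎
    where
    open ≡-Reasoning
    f = λ x → ind (θ x) y₀ * g x

  dynkin⇒lumps : All (λ x → θ x ∈ S') S → All (λ y → Σ[ x ∈ List ℕ ] (x ∈ S × θ x ≡ y)) S' →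
    Lumps S K S' K' θ
  dynkin⇒lumps θ-into θ-onto = θ-into , θ-onto , λ μ _ y₀ ys _ ys∈S' → sumL-pathW ys ys∈S' y₀ μ

-- Every element of S occurs in S exactly once.
Sifting : List (List ℕ) → Set
Sifting S = ∀ w → w ∈ S → ∀ (g : List ℕ → ℚ) → sumL S (λ z → ind z w * g z) ≡ g w

dynkin-id : ∀ {S K} {θ : List ℕ → List ℕ} → Sifting S → (∀ x → x ∈ S → θ x ≡ x) → DynkinCriterion S K S K θ
dynkin-id {S} {K} {θ} sifting θ≡id x x∈S y y∈S = begin
  sumL S (λ x' → ind (θ x') y * K x x')  ≡⟨ sumL-cong-∈ S (λ x' x'∈S → cong (λ z → ind z y * K x x') (θ≡id x' x'∈S)) ⟩
  sumL S (λ x' → ind x' y * K x x')      ≡⟨ sifting y y∈S (K x) ⟩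
  K x y                                  ≡⟨ cong (λ z → K z y) (sym (θ≡id x x∈S)) ⟩
  K (θ x) y                              ∎
  where open ≡-Reasoning

dynkin-∘ : ∀ {S₁ K₁ S₂ K₂ S₃ K₃} {θ₁ θ₂ θ : List ℕ → List ℕ} → Sifting S₂ →
  (∀ x → x ∈ S₁ → θ₁ x ∈ S₂) → (∀ x → θ x ≡ θ₂ (θ₁ x)) →
  DynkinCriterion S₁ K₁ S₂ K₂ θ₁ → DynkinCriterion S₂ K₂ S₃ K₃ θ₂ → DynkinCriterion S₁ K₁ S₃ K₃ θ
dynkin-∘ {S₁} {K₁} {S₂} {K₂} {S₃} {K₃} {θ₁} {θ₂} {θ} sifting θ₁-into θ≡θ₂∘θ₁ dynkin₁ dynkin₂ x x∈S₁ y y∈S₃ = begin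
  sumL S₁ (λ x' → ind (θ x') y * K₁ x x')
    ≡⟨ sumL-cong-∈ S₁ (λ x' x'∈S₁ → cong (_* K₁ x x') (trans (cong (λ z → ind z y) (θ≡θ₂∘θ₁ x'))
          (sym (sifting (θ₁ x') (θ₁-into x' x'∈S₁) (λ z → ind (θ₂ z) y))))) ⟩
  sumL S₁ (λ x' → sumL S₂ (λ z → ind z (θ₁ x') * ind (θ₂ z) y) * K₁ x x')
    ≡⟨ sumL-cong S₁ (λ x' → trans (sym (sumL-*ʳ S₂ (K₁ x x') (λ z → ind z (θ₁ x') * ind (θ₂ z) y)))
          (sumL-cong S₂ (λ z → trans (cong (λ t → t * ind (θ₂ z) y * K₁ x x') (ind-sym z (θ₁ x')))
             (rearrange (ind (θ₁ x') z) (ind (θ₂ z) y) (K₁ x x'))))) ⟩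
  sumL S₁ (λ x' → sumL S₂ (λ z → ind (θ₂ z) y * (ind (θ₁ x') z * K₁ x x')))
    ≡⟨ sumL-comm S₁ S₂ (λ x' z → ind (θ₂ z) y * (ind (θ₁ x') z * K₁ x x')) ⟩
  sumL S₂ (λ z → sumL S₁ (λ x' → ind (θ₂ z) y * (ind (θ₁ x') z * K₁ x x')))
    ≡⟨ sumL-cong S₂ (λ z → sumL-*ˡ S₁ (ind (θ₂ z) y) (λ x' → ind (θ₁ x') z * K₁ x x')) ⟩
  sumL S₂ (λ z → ind (θ₂ z) y * sumL S₁ (λ x' → ind (θ₁ x') z * K₁ x x'))
    ≡⟨ sumL-cong-∈ S₂ (λ z z∈S₂ → cong (ind (θ₂ z) y *_) (dynkin₁ x x∈S₁ z z∈S₂)) ⟩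
  sumL S₂ (λ z → ind (θ₂ z) y * K₂ (θ₁ x) z)
    ≡⟨ dynkin₂ (θ₁ x) (θ₁-into x x∈S₁) y y∈S₃ ⟩
  K₃ (θ₂ (θ₁ x)) y
    ≡⟨ cong (λ z → K₃ z y) (sym (θ≡θ₂∘θ₁ x)) ⟩
  K₃ (θ x) y ∎
  where
  open ≡-Reasoning
  rearrange : ∀ a b c → a * b * c ≡ b * (a * c)
  rearrange = solve 3 (λ a b c → a :* b :* c := b :* (a :* c)) refl

letters : ℕ → List ℕ
letters zero    = []
letters (suc m) = suc m ∷ letters m

letters-bounded : ∀ m → All (λ a → 0 < a × a ≤ m) (letters m)
letters-bounded zero    = []
letters-bounded (suc m) = (s≤s z≤n , ℕP.≤-refl) ∷ All.map (λ (0<a , a≤m) → 0<a , ℕP.m≤n⇒m≤1+n a≤m) (letters-bounded m)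

∈letters⇒bounded : ∀ {m a} → a ∈ letters m → 0 < a × a ≤ m
∈letters⇒bounded {m} a∈ = All.lookup (letters-bounded m) a∈

length-letters : ∀ m → length (letters m) ≡ m
length-letters zero    = refl
length-letters (suc m) = cong suc (length-letters m)

suc∉letters : ∀ m → suc m ∉ letters m
suc∉letters m m+1∈ = ℕP.<-irrefl refl (proj₂ (∈letters⇒bounded m+1∈))

letters-unique : ∀ m → Unique (letters m)
letters-unique zero    = []
letters-unique (suc m) = All.map (λ (_ , a≤m) m+1≡a → ℕP.<-irrefl (sym m+1≡a) (s≤s a≤m)) (letters-bounded m) ∷ letters-unique m

↭letters⇒unique : ∀ m {x} → x ↭ letters m → Unique x
↭letters⇒unique m x↭ = PermSetoidP.Unique-resp-↭ (setoid ℕ) (↭⇒↭ₛ (↭-sym x↭)) (letters-unique m)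

↭letters⇒length : ∀ m {x} → x ↭ letters m → length x ≡ m
↭letters⇒length m x↭ = trans (PermP.↭-length x↭) (length-letters m)

insertAt-↭ : ∀ a i (w : List ℕ) → insertAt a i w ↭ a ∷ w
insertAt-↭ a zero    w       = ↭-refl
insertAt-↭ a (suc i) []      = ↭-refl
insertAt-↭ a (suc i) (y ∷ w) = ↭-trans (↭-prep y (insertAt-↭ a i w)) (↭-swap y a ↭-refl)

∈perms⇒↭ : ∀ m {x} → x ∈ perms m → x ↭ letters m
∈perms⇒↭ m = All.lookup (perms-sound m)
  where
  perms-sound : ∀ m → All (_↭ letters m) (perms m)
  perms-sound zero    = ↭-refl ∷ []
  perms-sound (suc m) = AllP.concat⁺ (AllP.map⁺ (All.map
    (λ {p} p↭ → AllP.map⁺ (AllP.applyUpTo⁺₁ _ (suc m) (λ {i} _ → ↭-trans (insertAt-↭ (suc m) i p) (↭-prep (suc m) p↭))))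
    (perms-sound m)))

insertAt-length : ∀ c (A B : List ℕ) → insertAt c (length A) (A ++ B) ≡ A ++ c ∷ B
insertAt-length c []      B = refl
insertAt-length c (a ∷ A) B = cong (a ∷_) (insertAt-length c A B)

insertAt≡⇒ : ∀ c i (p A B : List ℕ) → c ∉ p → c ∉ A → i ≤ length p →
  insertAt c i p ≡ A ++ c ∷ B → i ≡ length A × p ≡ A ++ B
insertAt≡⇒ c zero    p       []      B _   _   _ eq = refl , LP.∷-injectiveʳ eq
insertAt≡⇒ c zero    p       (a ∷ A) B _   c∉A _ eq = ⊥-elim (c∉A (here (LP.∷-injectiveˡ eq)))
insertAt≡⇒ c (suc i) (b ∷ p) []      B c∉p _   _ eq = ⊥-elim (c∉p (here (sym (LP.∷-injectiveˡ eq))))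
insertAt≡⇒ c (suc i) (b ∷ p) (a ∷ A) B c∉p c∉A (s≤s i≤) eq with LP.∷-injective eq
... | refl , eq′ with insertAt≡⇒ c i p A B (c∉p ∘ there) (c∉A ∘ there) i≤ eq′
... | refl , refl = refl , refl

ind-insertAt : ∀ c i (p A B : List ℕ) → c ∉ p → c ∉ A → i ≤ length p →
  ind (insertAt c i p) (A ++ c ∷ B) ≡ δ i (length A) * ind p (A ++ B)
ind-insertAt c i p A B c∉p c∉A i≤ = by-cases (i ℕ.≟ length A) (≡-dec ℕ._≟_ p (A ++ B))
  where
  ≢⇒ind≡0 : ¬ (i ≡ length A × p ≡ A ++ B) → ind (insertAt c i p) (A ++ c ∷ B) ≡ 0ℚ
  ≢⇒ind≡0 ¬both = ind-≢ (¬both ∘ insertAt≡⇒ c i p A B c∉p c∉A i≤)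
  by-cases : Dec (i ≡ length A) → Dec (p ≡ A ++ B) → ind (insertAt c i p) (A ++ c ∷ B) ≡ δ i (length A) * ind p (A ++ B)
  by-cases (yes refl) (yes refl) = trans (cong (λ z → ind z (A ++ c ∷ B)) (insertAt-length c A B))
    (trans (ind-refl (A ++ c ∷ B)) (sym (trans (cong₂ _*_ (δ-refl (length A)) (ind-refl (A ++ B))) (ℚP.*-identityˡ 1ℚ))))
  by-cases (yes _)    (no p≢)    = trans (≢⇒ind≡0 (p≢ ∘ proj₂))
    (sym (trans (cong (δ i (length A) *_) (ind-≢ p≢)) (ℚP.*-zeroʳ (δ i (length A)))))
  by-cases (no i≢)    _          = trans (≢⇒ind≡0 (i≢ ∘ proj₁))
    (sym (trans (cong (_* ind p (A ++ B)) (δ-≢ i≢)) (ℚP.*-zeroˡ (ind p (A ++ B)))))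

-- x = A ++ (m+1) ∷ B is reached only by inserting m+1 at position |A| of A ++ B ∈ 𝔖ₘ.
sumL-perms-ind : ∀ m x → x ↭ letters m → ∀ (g : List ℕ → ℚ) → sumL (perms m) (λ τ → ind τ x * g τ) ≡ g x
sumL-perms-ind zero x x↭ g rewrite PermP.↭-empty-inv x↭ =
  trans (cong (_+ 0ℚ) (trans (cong (_* g []) (ind-refl [])) (ℚP.*-identityˡ (g [])))) (ℚP.+-identityʳ (g []))
sumL-perms-ind (suc m) x x↭ g with ∈-∃++ (PermP.∈-resp-↭ (↭-sym x↭) (here refl))
... | A , B , refl = begin
  sumL (concatMap insertions (perms m)) h
    ≡⟨ sumL-concatMap insertions (perms m) h ⟩
  sumL (perms m) (λ p → sumL (insertions p) h)
    ≡⟨ sumL-cong (perms m) (λ p → sumL-map (λ i → insertAt c i p) (upTo (suc m)) h) ⟩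
  sumL (perms m) (λ p → sumL (upTo (suc m)) (λ i → h (insertAt c i p)))
    ≡⟨ sumL-cong-∈ (perms m) (λ p p∈ → trans (sumL-upTo-cong (suc m) (λ i i<m+1 → h-insertAt p p∈ i i<m+1))
         (sumL-upTo-δ (suc m) (length A) (λ i → ind p (A ++ B) * g (insertAt c i p)) |A|<m+1)) ⟩
  sumL (perms m) (λ p → ind p (A ++ B) * g (insertAt c (length A) p))
    ≡⟨ sumL-perms-ind m (A ++ B) A++B↭ (λ p → g (insertAt c (length A) p)) ⟩
  g (insertAt c (length A) (A ++ B))
    ≡⟨ cong g (insertAt-length c A B) ⟩
  g (A ++ c ∷ B) ∎
  where
  open ≡-Reasoning
  c = suc m
  insertions = λ p → map (λ i → insertAt c i p) (upTo (suc m))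
  h = λ τ → ind τ (A ++ c ∷ B) * g τ
  A++B↭ : A ++ B ↭ letters m
  A++B↭ = PermP.drop-mid A [] x↭
  c∉A : c ∉ A
  c∉A c∈A = suc∉letters m (PermP.∈-resp-↭ A++B↭ (∈-++⁺ˡ c∈A))
  |A|<m+1 : length A < suc m
  |A|<m+1 = s≤s (ℕP.≤-trans (ℕP.m≤m+n (length A) (length B))
    (ℕP.≤-reflexive (trans (sym (LP.length-++ A)) (↭letters⇒length m A++B↭))))
  h-insertAt : ∀ p → p ∈ perms m → ∀ i → i < suc m →
    h (insertAt c i p) ≡ δ i (length A) * (ind p (A ++ B) * g (insertAt c i p))
  h-insertAt p p∈ i (s≤s i≤m) = trans
    (cong (_* g (insertAt c i p)) (ind-insertAt c i p A B c∉p c∉A i≤|p|))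
    (ℚP.*-assoc (δ i (length A)) (ind p (A ++ B)) (g (insertAt c i p)))
    where
    p↭ = ∈perms⇒↭ m p∈
    c∉p : c ∉ p
    c∉p c∈p = suc∉letters m (PermP.∈-resp-↭ p↭ c∈p)
    i≤|p| : i ≤ length p
    i≤|p| = ℕP.≤-trans i≤m (ℕP.≤-reflexive (sym (↭letters⇒length m p↭)))

-- If x were missing from perms m, the sum in sumL-perms-ind would be 0 rather than 1.
↭letters⇒∈perms : ∀ m {x} → x ↭ letters m → x ∈ perms m
↭letters⇒∈perms m {x} x↭ with DecMembership._∈?_ (≡-dec ℕ._≟_) x (perms m)
... | yes x∈ = x∈
... | no  x∉ = ⊥-elim (ℚP.1≢0 (trans (sym (sumL-perms-ind m x x↭ (λ _ → 1ℚ))) (sum-ind-∉ (perms m) x∉)))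
  where
  sum-ind-∉ : ∀ S → x ∉ S → sumL S (λ τ → ind τ x * 1ℚ) ≡ 0ℚ
  sum-ind-∉ []      _  = refl
  sum-ind-∉ (τ ∷ S) x∉ = trans
    (cong₂ _+_ (trans (cong (_* 1ℚ) (ind-≢ (λ τ≡x → x∉ (here (sym τ≡x))))) (ℚP.*-zeroˡ 1ℚ)) (sum-ind-∉ S (x∉ ∘ there)))
    (ℚP.+-identityˡ 0ℚ)

perms-sifting : ∀ m → Sifting (perms m)
perms-sifting m x x∈ = sumL-perms-ind m x (∈perms⇒↭ m x∈)

rank-∷-< : ∀ {a b} w → b < a → rank a (b ∷ w) ≡ suc (rank a w)
rank-∷-< {a} w b<a = cong length (LP.filter-accept (ℕ._<? a) b<a)

rank-∷-≮ : ∀ {a b} w → ¬ b < a → rank a (b ∷ w) ≡ rank a w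
rank-∷-≮ {a} w b≮a = cong length (LP.filter-reject (ℕ._<? a) b≮a)

rank-↭ : ∀ a {xs ys} → xs ↭ ys → rank a xs ≡ rank a ys
rank-↭ a xs↭ys = PermP.↭-length (PermP.filter-↭ (ℕ._<? a) xs↭ys)

rank≤length : ∀ a w → rank a w ≤ length w
rank≤length a w = LP.length-filter (ℕ._<? a) w

rank-mono-≤ : ∀ {a b} w → a ≤ b → rank a w ≤ rank b w
rank-mono-≤ []      _ = z≤n
rank-mono-≤ {a} {b} (c ∷ w) a≤b with c ℕ.<? a | c ℕ.<? b
... | yes c<a | yes c<b rewrite rank-∷-< w c<a | rank-∷-< w c<b = s≤s (rank-mono-≤ w a≤b)
... | yes c<a | no  c≮b = ⊥-elim (c≮b (ℕP.<-≤-trans c<a a≤b))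
... | no  c≮a | yes c<b rewrite rank-∷-≮ w c≮a | rank-∷-< w c<b = ℕP.m≤n⇒m≤1+n (rank-mono-≤ w a≤b)
... | no  c≮a | no  c≮b rewrite rank-∷-≮ w c≮a | rank-∷-≮ w c≮b = rank-mono-≤ w a≤b

rank-mono-< : ∀ {a b} w → b < a → b ∈ w → rank b w < rank a w
rank-mono-< {a} {b} (c ∷ w) b<a (here refl)
  rewrite rank-∷-≮ w (ℕP.<-irrefl {b} refl) | rank-∷-< w b<a = s≤s (rank-mono-≤ w (ℕP.<⇒≤ b<a))
rank-mono-< {a} {b} (c ∷ w) b<a (there b∈w) with c ℕ.<? b | c ℕ.<? a
... | yes c<b | yes c<a rewrite rank-∷-< w c<b | rank-∷-< w c<a = s≤s (rank-mono-< w b<a b∈w)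
... | yes c<b | no  c≮a = ⊥-elim (c≮a (ℕP.<-trans c<b b<a))
... | no  c≮b | yes c<a rewrite rank-∷-≮ w c≮b | rank-∷-< w c<a = ℕP.m≤n⇒m≤1+n (rank-mono-< w b<a b∈w)
... | no  c≮b | no  c≮a rewrite rank-∷-≮ w c≮b | rank-∷-≮ w c≮a = rank-mono-< w b<a b∈w

OrderPreservingAt : (ℕ → ℕ) → List ℕ → ℕ → Set
OrderPreservingAt f w a = ∀ b → b ∈ w → (b < a → f b < f a) × (f b < f a → b < a)

rank-map : ∀ (f : ℕ → ℕ) a w → OrderPreservingAt f w a → rank (f a) (map f w) ≡ rank a w
rank-map f a []      _ = refl
rank-map f a (b ∷ w) f-ord with b ℕ.<? a | f b ℕ.<? f a
... | yes b<a | yes fb<fa rewrite rank-∷-< w b<a | rank-∷-< (map f w) fb<fa = cong suc (rank-map f a w (λ c → f-ord c ∘ there))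
... | yes b<a | no  fb≮fa = ⊥-elim (fb≮fa (proj₁ (f-ord b (here refl)) b<a))
... | no  b≮a | yes fb<fa = ⊥-elim (b≮a (proj₂ (f-ord b (here refl)) fb<fa))
... | no  b≮a | no  fb≮fa rewrite rank-∷-≮ w b≮a | rank-∷-≮ (map f w) fb≮fa = rank-map f a w (λ c → f-ord c ∘ there)

map-cong-∈ : ∀ {f g : ℕ → ℕ} (w : List ℕ) → (∀ x → x ∈ w → f x ≡ g x) → map f w ≡ map g w
map-cong-∈ w f≡g = LP.map-cong-local (All.tabulate (λ {x} → f≡g x))

stdFrom-map : ∀ off (f : ℕ → ℕ) w → (∀ a → a ∈ w → OrderPreservingAt f w a) → stdFrom off (map f w) ≡ stdFrom off w
stdFrom-map off f w f-ord = trans (sym (LP.map-∘ w))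
  (map-cong-∈ w (λ a a∈w → cong (λ r → off ℕ.+ suc r) (rank-map f a w (f-ord a a∈w))))

strictMono⇒orderPreservingAt : ∀ {f : ℕ → ℕ} → f Preserves _<_ ⟶ _<_ → ∀ w a → OrderPreservingAt f w a
strictMono⇒orderPreservingAt {f} f-mono w a b _ = f-mono , λ fb<fa → ℕP.≰⇒> (λ a≤b → ℕP.<⇒≱ fb<fa (f-mono-≤ a≤b))
  where
  f-mono-≤ : ∀ {x y} → x ≤ y → f x ≤ f y
  f-mono-≤ x≤y with ℕP.m≤n⇒m<n∨m≡n x≤y
  ... | inj₁ x<y  = ℕP.<⇒≤ (f-mono x<y)
  ... | inj₂ refl = ℕP.≤-refl

strictMono⇒injective : ∀ {f : ℕ → ℕ} → f Preserves _<_ ⟶ _<_ → ∀ {a b} → f a ≡ f b → a ≡ b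
strictMono⇒injective f-mono {a} {b} fa≡fb with ℕP.<-cmp a b
... | tri< a<b _ _ = ⊥-elim (ℕP.<-irrefl fa≡fb (f-mono a<b))
... | tri≈ _ a≡b _ = a≡b
... | tri> _ _ b<a = ⊥-elim (ℕP.<-irrefl (sym fa≡fb) (f-mono b<a))

stdValue : ℕ → List ℕ → ℕ → ℕ
stdValue off w x = off ℕ.+ suc (rank x w)

stdValue-orderPreservingAt : ∀ off w a → OrderPreservingAt (stdValue off w) w a
stdValue-orderPreservingAt off w a b b∈w =
  (λ b<a → ℕP.+-monoʳ-< off (s≤s (rank-mono-< w b<a b∈w))) ,
  (λ vb<va → ℕP.≰⇒> (λ a≤b → ℕP.<⇒≱ vb<va (ℕP.+-monoʳ-≤ off (s≤s (rank-mono-≤ w a≤b)))))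

∈-drop⁻ : ∀ j {x} (w : List ℕ) → x ∈ drop j w → x ∈ w
∈-drop⁻ zero    w       x∈ = x∈
∈-drop⁻ (suc j) (y ∷ w) x∈ = there (∈-drop⁻ j w x∈)

stdFrom-drop-stdFrom : ∀ off′ off j w → stdFrom off′ (drop j (stdFrom off w)) ≡ stdFrom off′ (drop j w)
stdFrom-drop-stdFrom off′ off j w = trans (cong (stdFrom off′) (LP.drop-map j w))
  (stdFrom-map off′ (stdValue off w) (drop j w) (λ a _ b b∈ → stdValue-orderPreservingAt off w a b (∈-drop⁻ j w b∈)))

stdFrom≡map-+-std : ∀ off w → stdFrom off w ≡ map (off ℕ.+_) (std w)
stdFrom≡map-+-std off w = LP.map-∘ w

stdFrom-suc : ∀ off w → stdFrom (suc off) w ≡ map suc (stdFrom off w)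
stdFrom-suc off w = LP.map-∘ w

bump : ℕ → ℕ → ℕ
bump c v with v ℕ.<? c
... | yes _ = v
... | no  _ = suc v

bump-< : ∀ {c v} → v < c → bump c v ≡ v
bump-< {c} {v} v<c with v ℕ.<? c
... | yes _   = refl
... | no  v≮c = ⊥-elim (v≮c v<c)

bump-≮ : ∀ {c v} → ¬ v < c → bump c v ≡ suc v
bump-≮ {c} {v} v≮c with v ℕ.<? c
... | yes v<c = ⊥-elim (v≮c v<c)
... | no  _   = refl

bump-strictMono : ∀ c → bump c Preserves _<_ ⟶ _<_
bump-strictMono c {b} {a} b<a = by-cases (a ℕ.<? c) (b ℕ.<? c)
  where
  by-cases : Dec (a < c) → Dec (b < c) → bump c b < bump c a
  by-cases (yes a<c) (yes b<c) = subst₂ _<_ (sym (bump-< b<c)) (sym (bump-< a<c)) b<a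
  by-cases (yes a<c) (no  b≮c) = ⊥-elim (b≮c (ℕP.<-trans b<a a<c))
  by-cases (no  a≮c) (yes b<c) = subst₂ _<_ (sym (bump-< b<c)) (sym (bump-≮ a≮c)) (ℕP.m<n⇒m<1+n b<a)
  by-cases (no  a≮c) (no  b≮c) = subst₂ _<_ (sym (bump-≮ b≮c)) (sym (bump-≮ a≮c)) (s≤s b<a)

bump-injective : ∀ c {a b} → bump c a ≡ bump c b → a ≡ b
bump-injective c = strictMono⇒injective (bump-strictMono c)

std-∷ : ∀ a w → a ∉ w → std (a ∷ w) ≡ suc (rank a w) ∷ map (bump (suc (rank a w))) (std w)
std-∷ a w a∉w = cong₂ _∷_ (cong suc (rank-∷-≮ w (ℕP.<-irrefl {a} refl))) (trans (map-cong-∈ w value) (LP.map-∘ w))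
  where
  value : ∀ x → x ∈ w → suc (rank x (a ∷ w)) ≡ bump (suc (rank a w)) (suc (rank x w))
  value x x∈w with ℕP.<-cmp a x
  ... | tri< a<x _ _ rewrite rank-∷-< w a<x =
    sym (bump-≮ (λ x<a → ℕP.<⇒≱ x<a (s≤s (rank-mono-≤ w (ℕP.<⇒≤ a<x)))))
  ... | tri≈ _ refl _ = ⊥-elim (a∉w x∈w)
  ... | tri> _ _ x<a rewrite rank-∷-≮ {x} {a} w (ℕP.<⇒≯ x<a) = sym (bump-< (s≤s (rank-mono-< w x<a x∈w)))

map-bump-letters : ∀ c m → m < c → map (bump c) (letters m) ≡ letters m
map-bump-letters c m m<c = trans (map-cong-∈ (letters m) (λ x x∈ → bump-< (ℕP.≤-<-trans (proj₂ (∈letters⇒bounded x∈)) m<c)))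
                                 (LP.map-id (letters m))

∷-map-bump-letters : ∀ m c → 0 < c → c ≤ suc m → c ∷ map (bump c) (letters m) ↭ letters (suc m)
∷-map-bump-letters zero    c 0<c c≤1 rewrite ℕP.≤-antisym c≤1 0<c = ↭-refl
∷-map-bump-letters (suc m) c 0<c c≤m+2 with ℕP.m≤n⇒m<n∨m≡n c≤m+2
... | inj₂ refl rewrite map-bump-letters c (suc m) ℕP.≤-refl = ↭-refl
... | inj₁ (s≤s c≤m+1) rewrite bump-≮ {c} {suc m} (ℕP.≤⇒≯ c≤m+1) =
  ↭-trans (↭-swap c (suc (suc m)) ↭-refl) (↭-prep (suc (suc m)) (∷-map-bump-letters m c 0<c c≤m+1))

std-↭-letters : ∀ w → Unique w → std w ↭ letters (length w)
std-↭-letters []      _ = ↭-refl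
std-↭-letters (a ∷ w) u@(_ ∷ w-unique) rewrite std-∷ a w (UniqueP.Unique[x∷xs]⇒x∉xs u) =
  ↭-trans (↭-prep (suc (rank a w)) (PermP.map⁺ (bump (suc (rank a w))) (std-↭-letters w w-unique)))
          (∷-map-bump-letters (length w) (suc (rank a w)) (s≤s z≤n) (s≤s (rank≤length a w)))

rank-letters : ∀ a m → 0 < a → a ≤ suc m → rank a (letters m) ≡ pred a
rank-letters a zero    0<a a≤1 rewrite ℕP.≤-antisym a≤1 0<a = refl
rank-letters a (suc m) 0<a a≤m+2 with ℕP.m≤n⇒m<n∨m≡n a≤m+2
... | inj₁ (s≤s a≤m+1) = trans (rank-∷-≮ (letters m) (ℕP.≤⇒≯ a≤m+1)) (rank-letters a m 0<a a≤m+1)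
... | inj₂ refl        = trans (rank-∷-< {suc (suc m)} (letters m) ℕP.≤-refl)
                                (cong suc (rank-letters-all m (ℕP.<-trans (ℕP.n<1+n m) (ℕP.n<1+n (suc m)))))
  where
  rank-letters-all : ∀ {a} m → m < a → rank a (letters m) ≡ m
  rank-letters-all zero    _   = refl
  rank-letters-all (suc m) m<a = trans (rank-∷-< (letters m) m<a) (cong suc (rank-letters-all m (ℕP.<-trans ℕP.≤-refl m<a)))

std-↭letters : ∀ m x → x ↭ letters m → std x ≡ x
std-↭letters m x x↭ = trans (map-cong-∈ x value) (LP.map-id x)
  where
  value : ∀ a → a ∈ x → suc (rank a x) ≡ a
  value a a∈x with ∈letters⇒bounded {m} (PermP.∈-resp-↭ x↭ a∈x)
  ... | 0<a , a≤m = trans (cong suc (trans (rank-↭ a x↭) (rank-letters a m 0<a (ℕP.m≤n⇒m≤1+n a≤m))))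
                          (ℕP.suc-pred a {{ℕ.>-nonZero 0<a}})

std-drop-↭ : ∀ n j x → x ↭ letters n → std (drop j x) ↭ letters (n ∸ j)
std-drop-↭ n j x x↭ = subst (λ l → std (drop j x) ↭ letters l)
  (trans (LP.length-drop j x) (cong (_∸ j) (↭letters⇒length n x↭)))
  (std-↭-letters (drop j x) (UniqueP.drop⁺ j (↭letters⇒unique n x↭)))

theta-↭ : ∀ n k x → k ≤ n → x ↭ letters n → theta n k x ↭ letters k
theta-↭ n k x k≤n x↭ = subst (λ l → theta n k x ↭ letters l) (ℕP.m∸[m∸n]≡n k≤n) (std-drop-↭ n (n ∸ k) x x↭)

letters-+ : ∀ d k → letters (d ℕ.+ k) ≡ map (k ℕ.+_) (letters d) ++ letters k
letters-+ zero    k = refl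
letters-+ (suc d) k = cong₂ _∷_ (trans (cong suc (ℕP.+-comm d k)) (sym (ℕP.+-suc k d))) (letters-+ d k)

drop-length-++ : ∀ (A B : List ℕ) → drop (length A) (A ++ B) ≡ B
drop-length-++ []      B = refl
drop-length-++ (a ∷ A) B = drop-length-++ A B

-- A preimage of y: the letters k+1, …, n in decreasing order, followed by y.
theta-surjective : ∀ n k y → k ≤ n → y ↭ letters k → Σ[ x ∈ List ℕ ] (x ↭ letters n × theta n k x ≡ y)
theta-surjective n k y k≤n y↭ = prefix ++ y , x↭ , theta-x≡y
  where
  prefix = map (k ℕ.+_) (letters (n ∸ k))
  x↭ : prefix ++ y ↭ letters n
  x↭ = subst (λ l → prefix ++ y ↭ letters l) (ℕP.m∸n+n≡m k≤n)
         (subst (prefix ++ y ↭_) (sym (letters-+ (n ∸ k) k)) (PermP.++⁺ˡ prefix y↭))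
  |prefix|≡n∸k : length prefix ≡ n ∸ k
  |prefix|≡n∸k = trans (LP.length-map (k ℕ.+_) (letters (n ∸ k))) (length-letters (n ∸ k))
  theta-x≡y : theta n k (prefix ++ y) ≡ y
  theta-x≡y = trans (cong (λ j → std (drop j (prefix ++ y))) (sym |prefix|≡n∸k))
                    (trans (cong std (drop-length-++ prefix y)) (std-↭letters k y y↭))

theta-into-perms : ∀ n k → k ≤ n → All (λ x → theta n k x ∈ perms k) (perms n)
theta-into-perms n k k≤n = All.tabulate (λ {x} x∈ → ↭letters⇒∈perms k (theta-↭ n k x k≤n (∈perms⇒↭ n x∈)))

theta-onto-perms : ∀ n k → k ≤ n → All (λ y → Σ[ x ∈ List ℕ ] (x ∈ perms n × theta n k x ≡ y)) (perms k)
theta-onto-perms n k k≤n = All.tabulate λ {y} y∈ →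
  let (x , x↭ , theta-x≡y) = theta-surjective n k y k≤n (∈perms⇒↭ k y∈) in x , ↭letters⇒∈perms n x↭ , theta-x≡y

-- Top-to-random

drop-insertAt-≤ : ∀ c i d (w : List ℕ) → i ≤ d → drop (suc d) (insertAt c i w) ≡ drop d w
drop-insertAt-≤ c zero    d       w       _         = refl
drop-insertAt-≤ c (suc i) (suc d) []      _         = sym (LP.drop-[] (suc d))
drop-insertAt-≤ c (suc i) (suc d) (y ∷ w) (s≤s i≤d) = drop-insertAt-≤ c i d w i≤d

drop-insertAt-+ : ∀ c j d (w : List ℕ) → d ≤ length w → drop d (insertAt c (d ℕ.+ j) w) ≡ insertAt c j (drop d w)
drop-insertAt-+ c j zero    w       _         = refl
drop-insertAt-+ c j (suc d) (y ∷ w) (s≤s d≤w) = drop-insertAt-+ c j d w d≤w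

map-insertAt : ∀ (f : ℕ → ℕ) c j (u : List ℕ) → map f (insertAt c j u) ≡ insertAt (f c) j (map f u)
map-insertAt f c zero    u       = refl
map-insertAt f c (suc j) []      = refl
map-insertAt f c (suc j) (y ∷ u) = cong (f y ∷_) (map-insertAt f c j u)

std-insertAt-1 : ∀ j (u : List ℕ) → All (1 <_) u → std (insertAt 1 j u) ≡ insertAt 1 j (stdFrom 1 u)
std-insertAt-1 j u 1<u = trans (map-insertAt value 1 j u) (cong₂ (λ a b → insertAt a j b) value-1 (map-cong-∈ u value-u))
  where
  value = stdValue 0 (insertAt 1 j u)
  rank-1 : ∀ (u : List ℕ) → All (1 <_) u → rank 1 u ≡ 0
  rank-1 []      _         = refl
  rank-1 (y ∷ u) (1<y ∷ 1<u) = trans (rank-∷-≮ u (λ y<1 → ℕP.<-asym y<1 1<y)) (rank-1 u 1<u)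
  value-1 : value 1 ≡ 1
  value-1 = cong suc (trans (rank-↭ 1 (insertAt-↭ 1 j u)) (trans (rank-∷-≮ u (ℕP.<-irrefl refl)) (rank-1 u 1<u)))
  value-u : ∀ z → z ∈ u → value z ≡ stdValue 1 u z
  value-u z z∈u = cong suc (trans (rank-↭ z (insertAt-↭ 1 j u)) (rank-∷-< u (All.lookup 1<u z∈u)))

topToRandom : ℕ → List ℕ → List ℕ
topToRandom i x = insertAt 1 i (stdFrom 1 (drop 1 x))

topToRandom-↭ : ∀ m x i → x ↭ letters (suc m) → topToRandom i x ↭ letters (suc m)
topToRandom-↭ m x i x↭ = ↭-trans (insertAt-↭ 1 i (stdFrom 1 (drop 1 x))) (↭-trans (↭-prep 1 rest↭) 1∷suc-letters)
  where
  rest↭ : stdFrom 1 (drop 1 x) ↭ map suc (letters m)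
  rest↭ = subst (_↭ map suc (letters m)) (sym (stdFrom-suc 0 (drop 1 x))) (PermP.map⁺ suc (std-drop-↭ (suc m) 1 x x↭))
  1∷suc-letters : 1 ∷ map suc (letters m) ↭ letters (suc m)
  1∷suc-letters = subst (λ l → 1 ∷ l ↭ letters (suc m))
    (map-cong-∈ (letters m) (λ x x∈ → bump-≮ (λ x<1 → ℕP.<-irrefl refl (ℕP.<-≤-trans (proj₁ (∈letters⇒bounded x∈)) (ℕP.≤-pred x<1)))))
    (∷-map-bump-letters m 1 (s≤s z≤n) (s≤s z≤n))

sumL-perms-t2r : ∀ m x → x ↭ letters (suc m) → ∀ (f : List ℕ → ℚ) →
  sumL (perms (suc m)) (λ τ → f τ * t2r (suc m) x τ) ≡ inv (suc m) * sumL (upTo (suc m)) (λ i → f (topToRandom i x))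
sumL-perms-t2r m x x↭ f = begin
  sumL 𝔖 (λ τ → f τ * (c * sumL I (λ i → ind (topToRandom i x) τ)))
    ≡⟨ sumL-cong 𝔖 (λ τ → trans (rearrange (f τ) c (sumL I (λ i → ind (topToRandom i x) τ)))
                               (cong (c *_) (sym (sumL-*ʳ I (f τ) (λ i → ind (topToRandom i x) τ))))) ⟩
  sumL 𝔖 (λ τ → c * sumL I (λ i → ind (topToRandom i x) τ * f τ))
    ≡⟨ sumL-*ˡ 𝔖 c _ ⟩
  c * sumL 𝔖 (λ τ → sumL I (λ i → ind (topToRandom i x) τ * f τ))
    ≡⟨ cong (c *_) (sumL-comm 𝔖 I (λ τ i → ind (topToRandom i x) τ * f τ)) ⟩
  c * sumL I (λ i → sumL 𝔖 (λ τ → ind (topToRandom i x) τ * f τ))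
    ≡⟨ cong (c *_) (sumL-cong I (λ i → trans (sumL-cong 𝔖 (λ τ → cong (_* f τ) (ind-sym (topToRandom i x) τ)))
                                            (sumL-perms-ind (suc m) (topToRandom i x) (topToRandom-↭ m x i x↭) f))) ⟩
  c * sumL I (λ i → f (topToRandom i x)) ∎
  where
  open ≡-Reasoning
  𝔖 = perms (suc m)
  I = upTo (suc m)
  c = inv (suc m)
  rearrange : ∀ a b s → a * (b * s) ≡ b * (s * a)
  rearrange = solve 3 (λ a b s → a :* (b :* s) := b :* (s :* a)) refl

std-drop-topToRandom-< : ∀ d i a x′ → i < d → std (drop d (topToRandom i (a ∷ x′))) ≡ std (drop d (a ∷ x′))
std-drop-topToRandom-< (suc d) i a x′ (s≤s i≤d) =
  trans (cong std (drop-insertAt-≤ 1 i d (stdFrom 1 x′) i≤d)) (stdFrom-drop-stdFrom 0 1 d x′)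

std-drop-topToRandom-+ : ∀ d j a x′ → d ≤ length x′ →
  std (drop d (topToRandom (d ℕ.+ j) (a ∷ x′))) ≡ topToRandom j (std (drop d (a ∷ x′)))
std-drop-topToRandom-+ d j a x′ d≤|x′| = begin
  std (drop d (insertAt 1 (d ℕ.+ j) w))            ≡⟨ cong std (drop-insertAt-+ 1 j d w d≤|w|) ⟩
  std (insertAt 1 j (drop d w))                    ≡⟨ std-insertAt-1 j (drop d w) 1<drop-w ⟩
  insertAt 1 j (stdFrom 1 (drop d w))              ≡⟨ cong (insertAt 1 j) (stdFrom-drop-stdFrom 1 1 d x′) ⟩
  insertAt 1 j (stdFrom 1 (drop d x′))             ≡⟨ cong (λ z → insertAt 1 j (stdFrom 1 z)) drop-1-drop-d ⟩
  insertAt 1 j (stdFrom 1 (drop 1 (drop d x)))     ≡⟨ cong (insertAt 1 j) (sym (stdFrom-drop-stdFrom 1 0 1 (drop d x))) ⟩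
  insertAt 1 j (stdFrom 1 (drop 1 (std (drop d x)))) ∎
  where
  open ≡-Reasoning
  x = a ∷ x′
  w = stdFrom 1 x′
  d≤|w| : d ≤ length w
  d≤|w| = subst (d ≤_) (sym (LP.length-map (stdValue 1 x′) x′)) d≤|x′|
  1<drop-w : All (1 <_) (drop d w)
  1<drop-w = AllP.drop⁺ d (AllP.map⁺ (All.tabulate (λ _ → s≤s (s≤s z≤n))))
  drop-1-drop-d : drop d x′ ≡ drop 1 (drop d x)
  drop-1-drop-d = trans (cong (λ z → drop z x) (ℕP.+-comm 1 d)) (sym (LP.drop-drop d 1 x))

lazy-mixture : ∀ (n⁻¹ k⁻¹ d k I S : ℚ) → (d + k) * n⁻¹ ≡ 1ℚ → k * k⁻¹ ≡ 1ℚ →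
  n⁻¹ * (d * I + S) ≡ d * n⁻¹ * I + (1ℚ - d * n⁻¹) * (k⁻¹ * S)
lazy-mixture n⁻¹ k⁻¹ d k I S [d+k]*n⁻¹≡1 k*k⁻¹≡1 = sym (begin
  d * n⁻¹ * I + (1ℚ - d * n⁻¹) * (k⁻¹ * S)            ≡⟨ cong (λ z → d * n⁻¹ * I + (z - d * n⁻¹) * (k⁻¹ * S)) (sym [d+k]*n⁻¹≡1) ⟩
  d * n⁻¹ * I + ((d + k) * n⁻¹ - d * n⁻¹) * (k⁻¹ * S) ≡⟨ solve 6 (λ n⁻¹ k⁻¹ d k i s →
                                                           d :* n⁻¹ :* i :+ ((d :+ k) :* n⁻¹ :- d :* n⁻¹) :* (k⁻¹ :* s)
                                                           := d :* n⁻¹ :* i :+ n⁻¹ :* s :* (k :* k⁻¹)) refl n⁻¹ k⁻¹ d k I S ⟩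
  d * n⁻¹ * I + n⁻¹ * S * (k * k⁻¹)                   ≡⟨ cong (λ z → d * n⁻¹ * I + n⁻¹ * S * z) k*k⁻¹≡1 ⟩
  d * n⁻¹ * I + n⁻¹ * S * 1ℚ                          ≡⟨ solve 4 (λ n⁻¹ d i s → d :* n⁻¹ :* i :+ n⁻¹ :* s :* con 1ℚ
                                                                                := n⁻¹ :* (d :* i :+ s)) refl n⁻¹ d I S ⟩
  n⁻¹ * (d * I + S)                                   ∎)
  where open ≡-Reasoning

dynkin-t2r : ∀ n k → 1 ≤ k → k ≤ n →
  DynkinCriterion (perms n) (t2r n) (perms k) (lazy (fromℕ (n ∸ k) * inv n) (t2r k)) (theta n k)
dynkin-t2r (suc n′) (suc k′) _ k≤n [] x∈ y _ = ⊥-elim (ℕP.0≢1+n (↭letters⇒length (suc n′) (∈perms⇒↭ (suc n′) x∈)))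
dynkin-t2r (suc n′) (suc k′) _ k≤n (a ∷ x′) x∈ y _ = begin
  sumL (perms n) (λ τ → ind (θ τ) y * t2r n x τ)
    ≡⟨ sumL-perms-t2r n′ x x↭ (λ τ → ind (θ τ) y) ⟩
  inv n * sumL (upTo n) G
    ≡⟨ cong (λ z → inv n * sumL (upTo z) G) (sym (ℕP.m∸n+n≡m k≤n)) ⟩
  inv n * sumL (upTo (d ℕ.+ k)) G
    ≡⟨ cong (inv n *_) (sumL-upTo-+ d k G) ⟩
  inv n * (sumL (upTo d) G + sumL (upTo k) (λ j → G (d ℕ.+ j)))
    ≡⟨ cong (inv n *_) (cong₂ _+_ early late) ⟩
  inv n * (fromℕ d * I + S)
    ≡⟨ lazy-mixture (inv n) (inv k) (fromℕ d) (fromℕ k) I S [d+k]*inv-n≡1 (fromℕ*inv≡1 k′) ⟩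
  lazy (fromℕ d * inv n) (t2r k) (θ x) y ∎
  where
  open ≡-Reasoning
  n = suc n′
  k = suc k′
  d = n ∸ k
  θ = theta n k
  x = a ∷ x′
  x↭ = ∈perms⇒↭ n x∈
  G = λ i → ind (θ (topToRandom i x)) y
  I = ind (θ x) y
  S = sumL (upTo k) (λ j → ind (topToRandom j (θ x)) y)
  early : sumL (upTo d) G ≡ fromℕ d * I
  early = trans (sumL-upTo-cong d (λ i i<d → cong (λ z → ind z y) (std-drop-topToRandom-< d i a x′ i<d)))
                (sumL-upTo-const d I)
  d≤|x′| : d ≤ length x′
  d≤|x′| = subst (d ≤_) (sym (ℕP.suc-injective (↭letters⇒length n x↭))) (ℕP.m∸n≤m n′ k′)
  late : sumL (upTo k) (λ j → G (d ℕ.+ j)) ≡ S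
  late = sumL-upTo-cong k (λ j _ → cong (λ z → ind z y) (std-drop-topToRandom-+ d j a x′ d≤|x′|))
  [d+k]*inv-n≡1 : (fromℕ d + fromℕ k) * inv n ≡ 1ℚ
  [d+k]*inv-n≡1 = trans (cong (_* inv n) (sym (fromℕ-+ d k)))
                        (trans (cong (λ z → fromℕ z * inv n) (ℕP.m∸n+n≡m k≤n)) (fromℕ*inv≡1 n′))

-- Binomial top-to-random

nPk≡nP′k : ∀ {n k} → k ≤ n → n P k ≡ n P′ k
nPk≡nP′k k≤n = trans (nPk≡n!/[n∸k]! k≤n) (sym (nP′k≡n!/[n∸k]! k≤n))

nPk>0 : ∀ {n k} → k ≤ n → 0 < n P k
nPk>0 {n} {k} k≤n = subst (0 <_) (sym (nPk≡nP′k k≤n)) (nP′k>0 n k k≤n)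
  where
  nP′k>0 : ∀ n k → k ≤ n → 0 < n P′ k
  nP′k>0 n zero    _   = s≤s z≤n
  nP′k>0 n (suc k) k<n = ℕP.*-mono-≤ {1} {n ∸ k} {1} {n P′ k} (ℕP.m<n⇒0<n∸m k<n) (nP′k>0 n k (ℕP.<⇒≤ k<n))

nCk*k!≡nPk : ∀ {n k} → k ≤ n → (n C k) ℕ.* (k !) ≡ n P k
nCk*k!≡nPk {n} {k} k≤n = trans (cong (ℕ._* k !) (nCk≡nPk/k! k≤n))
  (m/n*n≡m {{ℕP._!≢0 k}} (subst (k ! ∣_) (sym (nPk≡nP′k k≤n)) (k!∣nP′k k≤n)))

binomialWeight : ℕ → ℚ → ℕ → ℚ
binomialWeight m q r = fromℕ (m C r) * pow (1ℚ - q) r * pow q (m ∸ r) * inv (m P r)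

binomialWeight≡ : ∀ m q r → r ≤ m → binomialWeight m q r ≡ pow (1ℚ - q) r * pow q (m ∸ r) * inv (r !)
binomialWeight≡ m q r r≤m = begin
  fromℕ (m C r) * p * pq * inv (m P r)  ≡⟨ solve 4 (λ c a b i → c :* a :* b :* i := a :* b :* (c :* i)) refl (fromℕ (m C r)) p pq (inv (m P r)) ⟩
  p * pq * (fromℕ (m C r) * inv (m P r)) ≡⟨ cong (p * pq *_) (fromℕ*inv-cancelˡ (m C r) (r !) (m P r) (nCk*k!≡nPk r≤m) (ℕP.1≤n! r) (nPk>0 r≤m)) ⟩
  p * pq * inv (r !)                     ∎
  where
  open ≡-Reasoning
  p = pow (1ℚ - q) r
  pq = pow q (m ∸ r)

binomialWeight-suc : ∀ m q s → s ≤ m →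
  binomialWeight (suc m) q (suc s) * fromℕ (suc s) + binomialWeight (suc m) q s ≡ binomialWeight m q s
binomialWeight-suc m q s s≤m = begin
  W (suc m) (suc s) * fromℕ (suc s) + W (suc m) s
    ≡⟨ cong₂ _+_ (cong (_* fromℕ (suc s)) (binomialWeight≡ (suc m) q (suc s) (s≤s s≤m)))
                 (binomialWeight≡ (suc m) q s (ℕP.m≤n⇒m≤1+n s≤m)) ⟩
  p * X * Y * inv (suc s !) * fromℕ (suc s) + X * pow q (suc m ∸ s) * inv (s !)
    ≡⟨ cong (λ z → p * X * Y * inv (suc s !) * fromℕ (suc s) + X * pow q z * inv (s !)) (ℕP.+-∸-assoc 1 s≤m) ⟩
  p * X * Y * inv (suc s !) * fromℕ (suc s) + X * (q * Y) * inv (s !)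
    ≡⟨ cong (_+ X * (q * Y) * inv (s !)) (trans (ℚP.*-assoc (p * X * Y) (inv (suc s !)) (fromℕ (suc s)))
          (cong (p * X * Y *_) (trans (ℚP.*-comm (inv (suc s !)) (fromℕ (suc s)))
            (fromℕ*inv-cancelˡ (suc s) (s !) (suc s !) refl (ℕP.1≤n! s) (ℕP.1≤n! (suc s)))))) ⟩
  p * X * Y * inv (s !) + X * (q * Y) * inv (s !)
    ≡⟨ solve 5 (λ q x y i p → p :* x :* y :* i :+ x :* (q :* y) :* i := (p :+ q) :* (x :* y :* i)) refl q X Y (inv (s !)) p ⟩
  (p + q) * (X * Y * inv (s !))
    ≡⟨ cong (_* (X * Y * inv (s !))) (solve 1 (λ q → con 1ℚ :- q :+ q := con 1ℚ) refl q) ⟩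
  1ℚ * (X * Y * inv (s !))
    ≡⟨ ℚP.*-identityˡ _ ⟩
  X * Y * inv (s !)
    ≡⟨ sym (binomialWeight≡ m q s s≤m) ⟩
  W m s ∎
  where
  open ≡-Reasoning
  W = λ m → binomialWeight m q
  p = 1ℚ - q
  X = pow p s
  Y = pow q (m ∸ s)

prepend : ℕ → List ℕ → List ℕ
prepend a y = suc a ∷ map (bump (suc a)) y

prepend-↭ : ∀ m a y → a < suc m → y ↭ letters m → prepend a y ↭ letters (suc m)
prepend-↭ m a y (s≤s a≤m) y↭ =
  ↭-trans (↭-prep (suc a) (PermP.map⁺ (bump (suc a)) y↭)) (∷-map-bump-letters m (suc a) (s≤s z≤n) (s≤s a≤m))

ind-std-drop-1 : ∀ m τ y → τ ↭ letters (suc m) → ind (std (drop 1 τ)) y ≡ sumL (upTo (suc m)) (λ a → ind (prepend a y) τ)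
ind-std-drop-1 m []      y τ↭ = ⊥-elim (ℕP.0≢1+n (↭letters⇒length (suc m) τ↭))
ind-std-drop-1 m (h ∷ t) y τ↭ = sym (begin
  sumL (upTo (suc m)) (λ a → ind (prepend a y) (h ∷ t))
    ≡⟨ sumL-cong (upTo (suc m)) (λ a → cong (ind (prepend a y)) τ≡) ⟩
  sumL (upTo (suc m)) (λ a → ind (prepend a y) (c ∷ map (bump c) (std t)))
    ≡⟨ sumL-cong (upTo (suc m)) (λ a → trans (ind-∷ (suc a) c (map (bump (suc a)) y) (map (bump c) (std t)))
          (cong (_* ind (map (bump (suc a)) y) (map (bump c) (std t))) (δ-suc a r))) ⟩
  sumL (upTo (suc m)) (λ a → δ a r * ind (map (bump (suc a)) y) (map (bump c) (std t)))
    ≡⟨ sumL-upTo-δ (suc m) r (λ a → ind (map (bump (suc a)) y) (map (bump c) (std t))) r<m+1 ⟩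
  ind (map (bump c) y) (map (bump c) (std t))
    ≡⟨ ind-map (bump c) (bump-injective c) y (std t) ⟩
  ind y (std t)
    ≡⟨ ind-sym y (std t) ⟩
  ind (std t) y ∎)
  where
  open ≡-Reasoning
  r = rank h t
  c = suc r
  τ≡ : h ∷ t ≡ c ∷ map (bump c) (std t)
  τ≡ = trans (sym (std-↭letters (suc m) (h ∷ t) τ↭)) (std-∷ h t (UniqueP.Unique[x∷xs]⇒x∉xs (↭letters⇒unique (suc m) τ↭)))
  r<m+1 : r < suc m
  r<m+1 = s≤s (ℕP.≤-trans (rank≤length h t) (ℕP.≤-reflexive (ℕP.suc-injective (↭letters⇒length (suc m) τ↭))))

above : ℕ → List ℕ → List ℕ
above r = filter (λ z → r ℕ.<? z)

above-map-bump-≤ : ∀ c s y → c ≤ suc s → above (suc s) (map (bump c) y) ≡ map suc (above s y)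
above-map-bump-≤ c s []      _ = refl
above-map-bump-≤ c s (v ∷ y) c≤s+1 with v ℕ.<? c | s ℕ.<? v
... | yes v<c | yes s<v = ⊥-elim (ℕP.<⇒≱ s<v (ℕP.≤-pred (ℕP.<-≤-trans v<c c≤s+1)))
... | yes v<c | no  s≮v rewrite LP.filter-reject (λ z → suc s ℕ.<? z) {v} {map (bump c) y} (s≮v ∘ ℕP.<-trans (ℕP.n<1+n s))
  | LP.filter-reject (λ z → s ℕ.<? z) {v} {y} s≮v = above-map-bump-≤ c s y c≤s+1
... | no  v≮c | yes s<v rewrite LP.filter-accept (λ z → suc s ℕ.<? z) {suc v} {map (bump c) y} (s≤s s<v)
  | LP.filter-accept (λ z → s ℕ.<? z) {v} {y} s<v = cong (suc v ∷_) (above-map-bump-≤ c s y c≤s+1)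
... | no  v≮c | no  s≮v rewrite LP.filter-reject (λ z → suc s ℕ.<? z) {suc v} {map (bump c) y} (s≮v ∘ ℕP.≤-pred)
  | LP.filter-reject (λ z → s ℕ.<? z) {v} {y} s≮v = above-map-bump-≤ c s y c≤s+1

above-map-bump-> : ∀ c r y → r < c → above r (map (bump c) y) ≡ map (bump c) (above r y)
above-map-bump-> c r []      _ = refl
above-map-bump-> c r (v ∷ y) r<c with v ℕ.<? c | r ℕ.<? v
... | yes v<c | yes r<v rewrite LP.filter-accept (λ z → r ℕ.<? z) {v} {map (bump c) y} r<v
  | LP.filter-accept (λ z → r ℕ.<? z) {v} {y} r<v = cong₂ _∷_ (sym (bump-< v<c)) (above-map-bump-> c r y r<c)
... | yes v<c | no  r≮v rewrite LP.filter-reject (λ z → r ℕ.<? z) {v} {map (bump c) y} r≮v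
  | LP.filter-reject (λ z → r ℕ.<? z) {v} {y} r≮v = above-map-bump-> c r y r<c
... | no  v≮c | yes r<v rewrite LP.filter-accept (λ z → r ℕ.<? z) {suc v} {map (bump c) y} (ℕP.m<n⇒m<1+n r<v)
  | LP.filter-accept (λ z → r ℕ.<? z) {v} {y} r<v = cong₂ _∷_ (sym (bump-≮ v≮c)) (above-map-bump-> c r y r<c)
... | no  v≮c | no  r≮v = ⊥-elim (r≮v (ℕP.<-≤-trans r<c (ℕP.≮⇒≥ v≮c)))

-- b2r m q σ τ = Σᵣ binomialWeight m q r * removal r σ τ
removal : ℕ → List ℕ → List ℕ → ℚ
removal r σ τ = ind (above r τ) (stdFrom r (drop r σ))

removal-suc-prepend : ∀ s a x₀ x′ y → a ≤ s → removal (suc s) (x₀ ∷ x′) (prepend a y) ≡ removal s (std x′) y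
removal-suc-prepend s a x₀ x′ y a≤s = begin
  ind (above (suc s) (prepend a y)) (stdFrom (suc s) (drop s x′))
    ≡⟨ cong₂ ind (trans (LP.filter-reject (λ z → suc s ℕ.<? z) {suc a} {map (bump (suc a)) y} (ℕP.≤⇒≯ (s≤s a≤s)))
                        (above-map-bump-≤ (suc a) s y (s≤s a≤s)))
                 (stdFrom-suc s (drop s x′)) ⟩
  ind (map suc (above s y)) (map suc (stdFrom s (drop s x′)))
    ≡⟨ ind-map suc ℕP.suc-injective (above s y) (stdFrom s (drop s x′)) ⟩
  ind (above s y) (stdFrom s (drop s x′))
    ≡⟨ cong (ind (above s y)) (sym (stdFrom-drop-stdFrom s 0 s x′)) ⟩
  removal s (std x′) y ∎
  where open ≡-Reasoning

+-bump : ∀ r c v → r ℕ.+ bump c v ≡ bump (r ℕ.+ c) (r ℕ.+ v)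
+-bump r c v with v ℕ.<? c
... | yes v<c = sym (bump-< (ℕP.+-monoʳ-< r v<c))
... | no  v≮c = trans (ℕP.+-suc r v) (sym (bump-≮ (v≮c ∘ ℕP.+-cancelˡ-< r v c)))

stdFrom-∷ : ∀ r a w → a ∉ w → stdFrom r (a ∷ w) ≡ (r ℕ.+ suc (rank a w)) ∷ map (bump (r ℕ.+ suc (rank a w))) (stdFrom r w)
stdFrom-∷ r a w a∉w = begin
  stdFrom r (a ∷ w)                                  ≡⟨ stdFrom≡map-+-std r (a ∷ w) ⟩
  map (r ℕ.+_) (std (a ∷ w))                         ≡⟨ cong (map (r ℕ.+_)) (std-∷ a w a∉w) ⟩
  c ∷ map (r ℕ.+_) (map (bump (suc (rank a w))) (std w))
    ≡⟨ cong (c ∷_) (trans (sym (LP.map-∘ (std w))) (trans (LP.map-cong (+-bump r (suc (rank a w))) (std w)) (LP.map-∘ (std w)))) ⟩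
  c ∷ map (bump c) (map (r ℕ.+_) (std w))            ≡⟨ cong (λ z → c ∷ map (bump c) z) (sym (stdFrom≡map-+-std r w)) ⟩
  c ∷ map (bump c) (stdFrom r w)                     ∎
  where
  open ≡-Reasoning
  c = r ℕ.+ suc (rank a w)

above-prepend : ∀ r a y → r ≤ a → above r (prepend a y) ≡ prepend a (above r y)
above-prepend r a y r≤a = trans (LP.filter-accept (λ z → r ℕ.<? z) {suc a} {map (bump (suc a)) y} (s≤s r≤a))
                                (cong (suc a ∷_) (above-map-bump-> (suc a) r y (s≤s r≤a)))

ind-∷-map-bump : ∀ c c′ u v → ind (c ∷ map (bump c) u) (c′ ∷ map (bump c′) v) ≡ δ c c′ * ind u v
ind-∷-map-bump c c′ u v = trans (ind-∷ c c′ (map (bump c) u) (map (bump c′) v)) (by-cases (c ℕ.≟ c′))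
  where
  by-cases : Dec (c ≡ c′) → δ c c′ * ind (map (bump c) u) (map (bump c′) v) ≡ δ c c′ * ind u v
  by-cases (yes refl) = cong (δ c c *_) (ind-map (bump c) (bump-injective c) u v)
  by-cases (no c≢c′)  = trans (cong (_* ind (map (bump c) u) (map (bump c′) v)) (δ-≢ c≢c′))
    (trans (ℚP.*-zeroˡ (ind (map (bump c) u) (map (bump c′) v))) (sym (trans (cong (_* ind u v) (δ-≢ c≢c′)) (ℚP.*-zeroˡ (ind u v)))))

δ-+ : ∀ r i j → δ (r ℕ.+ i) (r ℕ.+ j) ≡ δ i j
δ-+ zero    i j = refl
δ-+ (suc r) i j = trans (δ-suc (r ℕ.+ i) (r ℕ.+ j)) (δ-+ r i j)

drop-∷ : ∀ r (x₀ : ℕ) x′ → r ≤ length x′ → Σ[ a ∈ ℕ ] drop r (x₀ ∷ x′) ≡ a ∷ drop r x′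
drop-∷ zero    x₀ x′       _         = x₀ , refl
drop-∷ (suc r) x₀ (b ∷ x′) (s≤s r≤) = drop-∷ r b x′ r≤

-- Only the front letter r + 1 + #{i > r + 1 : xᵢ < xᵣ₊₁} contributes (positions in x counted from 1).
sumL-removal-prepend : ∀ m r x₀ x′ y → x₀ ∷ x′ ↭ letters (suc m) → r ≤ m →
  sumL (upTo (suc m ∸ r)) (λ j → removal r (x₀ ∷ x′) (prepend (r ℕ.+ j) y)) ≡ removal r (std x′) y
sumL-removal-prepend m r x₀ x′ y x↭ r≤m = begin
  sumL (upTo (suc m ∸ r)) (λ j → ind (above r (prepend (r ℕ.+ j) y)) (stdFrom r (drop r (x₀ ∷ x′))))
    ≡⟨ sumL-cong (upTo (suc m ∸ r)) (λ j → cong₂ ind (above-prepend r (r ℕ.+ j) y (ℕP.m≤m+n r j))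
                                                     (trans (cong (stdFrom r) drop-r-x≡) (stdFrom-∷ r a W a∉W))) ⟩
  sumL (upTo (suc m ∸ r)) (λ j → ind (prepend (r ℕ.+ j) F) (c ∷ map (bump c) V))
    ≡⟨ sumL-cong (upTo (suc m ∸ r)) (λ j → trans (ind-∷-map-bump (suc (r ℕ.+ j)) c F V) (cong (_* ind F V) (δ-shift j))) ⟩
  sumL (upTo (suc m ∸ r)) (λ j → δ j (rank a W) * ind F V)
    ≡⟨ sumL-upTo-δ (suc m ∸ r) (rank a W) (λ _ → ind F V) rank<m+1∸r ⟩
  ind F V
    ≡⟨ cong (ind F) (sym (stdFrom-drop-stdFrom r 0 r x′)) ⟩
  removal r (std x′) y ∎
  where
  open ≡-Reasoning
  |x′|≡m : length x′ ≡ m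
  |x′|≡m = ℕP.suc-injective (↭letters⇒length (suc m) x↭)
  W = drop r x′
  a = proj₁ (drop-∷ r x₀ x′ (subst (r ≤_) (sym |x′|≡m) r≤m))
  drop-r-x≡ = proj₂ (drop-∷ r x₀ x′ (subst (r ≤_) (sym |x′|≡m) r≤m))
  a∉W : a ∉ W
  a∉W = UniqueP.Unique[x∷xs]⇒x∉xs (subst Unique drop-r-x≡ (UniqueP.drop⁺ r (↭letters⇒unique (suc m) x↭)))
  c = r ℕ.+ suc (rank a W)
  F = above r y
  V = stdFrom r W
  δ-shift : ∀ j → δ (suc (r ℕ.+ j)) c ≡ δ j (rank a W)
  δ-shift j = trans (cong (λ z → δ z c) (sym (ℕP.+-suc r j))) (trans (δ-+ r (suc j) (suc (rank a W))) (δ-suc j (rank a W)))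
  rank<m+1∸r : rank a W < suc m ∸ r
  rank<m+1∸r = subst (rank a W <_) (sym (ℕP.+-∸-assoc 1 r≤m))
    (s≤s (ℕP.≤-trans (rank≤length a W) (ℕP.≤-reflexive (trans (LP.length-drop r x′) (cong (_∸ r) |x′|≡m)))))

sumL-regroup : ∀ m (W W′ Z J : ℕ → ℚ) →
  (∀ s → s ≤ m → W (suc s) * fromℕ (suc s) + W s ≡ W′ s) →
  Z 0 ≡ J 0 → (∀ s → s < m → Z (suc s) ≡ fromℕ (suc s) * J s + J (suc s)) → Z (suc m) ≡ fromℕ (suc m) * J m →
  sumL (upTo (suc (suc m))) (λ r → W r * Z r) ≡ sumL (upTo (suc m)) (λ s → W′ s * J s)
sumL-regroup m W W′ Z J W′≡ Z₀ Z-suc Z-last = begin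
  sumL (upTo (suc (suc m))) (λ r → W r * Z r)
    ≡⟨ sumL-upTo-suc (suc m) (λ r → W r * Z r) ⟩
  W 0 * Z 0 + sumL (upTo (suc m)) (λ s → W (suc s) * Z (suc s))
    ≡⟨ cong₂ _+_ (cong (W 0 *_) Z₀) (sumL-upTo-sucʳ m (λ s → W (suc s) * Z (suc s))) ⟩
  W 0 * J 0 + (sumL (upTo m) (λ s → W (suc s) * Z (suc s)) + W (suc m) * Z (suc m))
    ≡⟨ cong (W 0 * J 0 +_) (cong₂ _+_
         (trans (sumL-upTo-cong m (λ s s<m → trans (cong (W (suc s) *_) (Z-suc s s<m)) (distrib (W (suc s)) (fromℕ (suc s)) (J s) (J (suc s)))))
                (sumL-+ (upTo m) A C))
         (trans (cong (W (suc m) *_) Z-last) (sym (ℚP.*-assoc (W (suc m)) (fromℕ (suc m)) (J m))))) ⟩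
  W 0 * J 0 + (sumL (upTo m) A + sumL (upTo m) C + A m)
    ≡⟨ solve 4 (λ b a c e → b :+ (a :+ c :+ e) := a :+ e :+ (b :+ c)) refl (W 0 * J 0) (sumL (upTo m) A) (sumL (upTo m) C) (A m) ⟩
  sumL (upTo m) A + A m + (W 0 * J 0 + sumL (upTo m) C)
    ≡⟨ sym (cong₂ _+_ (sumL-upTo-sucʳ m A) (sumL-upTo-suc m (λ s → W s * J s))) ⟩
  sumL (upTo (suc m)) A + sumL (upTo (suc m)) (λ s → W s * J s)
    ≡⟨ sym (sumL-+ (upTo (suc m)) A (λ s → W s * J s)) ⟩
  sumL (upTo (suc m)) (λ s → A s + W s * J s)
    ≡⟨ sumL-upTo-cong (suc m) (λ s s≤m → trans (sym (ℚP.*-distribʳ-+ (J s) (W (suc s) * fromℕ (suc s)) (W s)))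
                                               (cong (_* J s) (W′≡ s (ℕP.≤-pred s≤m)))) ⟩
  sumL (upTo (suc m)) (λ s → W′ s * J s) ∎
  where
  open ≡-Reasoning
  A C : ℕ → ℚ
  A s = W (suc s) * fromℕ (suc s) * J s
  C s = W (suc s) * J (suc s)
  distrib : ∀ w f j j′ → w * (f * j + j′) ≡ w * f * j + w * j′
  distrib = solve 4 (λ w f j j′ → w :* (f :* j :+ j′) := w :* f :* j :+ w :* j′) refl

removal-prepend : ℕ → List ℕ → List ℕ → ℕ → ℚ
removal-prepend m x y r = sumL (upTo (suc m)) (λ a → removal r x (prepend a y))

module _ {m x₀ x′} (x↭ : x₀ ∷ x′ ↭ letters (suc m)) (y : List ℕ) where

  private
    x = x₀ ∷ x′

  removal-prepend-split : ∀ r → r ≤ suc m → removal-prepend m x y r ≡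
    sumL (upTo r) (λ a → removal r x (prepend a y)) + sumL (upTo (suc m ∸ r)) (λ j → removal r x (prepend (r ℕ.+ j) y))
  removal-prepend-split r r≤m+1 = trans (cong (λ z → sumL (upTo z) (λ a → removal r x (prepend a y))) (sym (ℕP.m+[n∸m]≡n r≤m+1)))
                                        (sumL-upTo-+ r (suc m ∸ r) (λ a → removal r x (prepend a y)))

  sumL-removal-suc-prepend : ∀ s → sumL (upTo (suc s)) (λ a → removal (suc s) x (prepend a y)) ≡ fromℕ (suc s) * removal s (std x′) y
  sumL-removal-suc-prepend s = trans (sumL-upTo-cong (suc s) (λ a a≤s → removal-suc-prepend s a x₀ x′ y (ℕP.≤-pred a≤s)))
                                     (sumL-upTo-const (suc s) (removal s (std x′) y))

  removal-prepend-zero : removal-prepend m x y 0 ≡ removal 0 (std x′) y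
  removal-prepend-zero = trans (removal-prepend-split 0 z≤n) (trans (ℚP.+-identityˡ _) (sumL-removal-prepend m 0 x₀ x′ y x↭ z≤n))

  removal-prepend-suc : ∀ s → s < m →
    removal-prepend m x y (suc s) ≡ fromℕ (suc s) * removal s (std x′) y + removal (suc s) (std x′) y
  removal-prepend-suc s s<m = trans (removal-prepend-split (suc s) (s≤s (ℕP.<⇒≤ s<m)))
    (cong₂ _+_ (sumL-removal-suc-prepend s) (sumL-removal-prepend m (suc s) x₀ x′ y x↭ s<m))

  removal-prepend-last : removal-prepend m x y (suc m) ≡ fromℕ (suc m) * removal m (std x′) y
  removal-prepend-last = begin
    removal-prepend m x y (suc m)
      ≡⟨ removal-prepend-split (suc m) ℕP.≤-refl ⟩
    sumL (upTo (suc m)) (λ a → removal (suc m) x (prepend a y)) + sumL (upTo (suc m ∸ suc m)) rest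
      ≡⟨ cong₂ _+_ (sumL-removal-suc-prepend m) (cong (λ z → sumL (upTo z) rest) (ℕP.n∸n≡0 m)) ⟩
    fromℕ (suc m) * removal m (std x′) y + 0ℚ
      ≡⟨ ℚP.+-identityʳ _ ⟩
    fromℕ (suc m) * removal m (std x′) y ∎
    where
    open ≡-Reasoning
    rest = λ j → removal (suc m) x (prepend (suc m ℕ.+ j) y)

dynkin-b2r-drop-1 : ∀ m q → DynkinCriterion (perms (suc m)) (b2r (suc m) q) (perms m) (b2r m q) (λ x → std (drop 1 x))
dynkin-b2r-drop-1 m q []         x∈ y y∈ = ⊥-elim (ℕP.0≢1+n (↭letters⇒length (suc m) (∈perms⇒↭ (suc m) x∈)))
dynkin-b2r-drop-1 m q (x₀ ∷ x′) x∈ y y∈ = begin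
  sumL 𝔖 (λ τ → ind (std (drop 1 τ)) y * K τ)
    ≡⟨ sumL-cong-∈ 𝔖 (λ τ τ∈ → trans (cong (_* K τ) (ind-std-drop-1 m τ y (∈perms⇒↭ (suc m) τ∈)))
                                     (sym (sumL-*ʳ I (K τ) (λ a → ind (prepend a y) τ)))) ⟩
  sumL 𝔖 (λ τ → sumL I (λ a → ind (prepend a y) τ * K τ))
    ≡⟨ sumL-comm 𝔖 I (λ τ a → ind (prepend a y) τ * K τ) ⟩
  sumL I (λ a → sumL 𝔖 (λ τ → ind (prepend a y) τ * K τ))
    ≡⟨ sumL-upTo-cong (suc m) (λ a a<m+1 → trans (sumL-cong 𝔖 (λ τ → cong (_* K τ) (ind-sym (prepend a y) τ)))
                                                 (sumL-perms-ind (suc m) (prepend a y) (prepend-↭ m a y a<m+1 y↭) K)) ⟩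
  sumL I (λ a → sumL R (λ r → binomialWeight (suc m) q r * removal r x (prepend a y)))
    ≡⟨ sumL-comm I R (λ a r → binomialWeight (suc m) q r * removal r x (prepend a y)) ⟩
  sumL R (λ r → sumL I (λ a → binomialWeight (suc m) q r * removal r x (prepend a y)))
    ≡⟨ sumL-cong R (λ r → sumL-*ˡ I (binomialWeight (suc m) q r) (λ a → removal r x (prepend a y))) ⟩
  sumL R (λ r → binomialWeight (suc m) q r * removal-prepend m x y r)
    ≡⟨ sumL-regroup m (binomialWeight (suc m) q) (binomialWeight m q) (removal-prepend m x y) (λ s → removal s (std x′) y)
         (binomialWeight-suc m q) (removal-prepend-zero x↭ y) (removal-prepend-suc x↭ y) (removal-prepend-last x↭ y) ⟩
  b2r m q (std x′) y ∎
  where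
  open ≡-Reasoning
  x = x₀ ∷ x′
  x↭ = ∈perms⇒↭ (suc m) x∈
  y↭ = ∈perms⇒↭ m y∈
  𝔖 = perms (suc m)
  I = upTo (suc m)
  R = upTo (suc (suc m))
  K = b2r (suc m) q x

dynkin-b2r : ∀ q d k → DynkinCriterion (perms (d ℕ.+ k)) (b2r (d ℕ.+ k) q) (perms k) (b2r k q) (theta (d ℕ.+ k) k)
dynkin-b2r q zero    k = dynkin-id (perms-sifting k) (λ x x∈ → trans (cong (λ j → std (drop j x)) (ℕP.n∸n≡0 k))
                                                                   (std-↭letters k x (∈perms⇒↭ k x∈)))
dynkin-b2r q (suc d) k = dynkin-∘ {K₂ = b2r (d ℕ.+ k) q} {K₃ = b2r k q} {θ₁ = λ x → std (drop 1 x)} (perms-sifting (d ℕ.+ k))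
  (λ x x∈ → ↭letters⇒∈perms (d ℕ.+ k) (std-drop-↭ (suc d ℕ.+ k) 1 x (∈perms⇒↭ (suc d ℕ.+ k) x∈)))
  theta≡ (dynkin-b2r-drop-1 (d ℕ.+ k) q) (dynkin-b2r q d k)
  where
  open ≡-Reasoning
  theta≡ : ∀ x → theta (suc d ℕ.+ k) k x ≡ theta (d ℕ.+ k) k (std (drop 1 x))
  theta≡ x = begin
    std (drop (suc d ℕ.+ k ∸ k) x)           ≡⟨ cong (λ j → std (drop j x)) (ℕP.m+n∸n≡m (suc d) k) ⟩
    std (drop (suc d) x)                     ≡⟨ cong std (sym (LP.drop-drop 1 d x)) ⟩
    std (drop d (drop 1 x))                  ≡⟨ sym (stdFrom-drop-stdFrom 0 0 d (drop 1 x)) ⟩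
    std (drop d (std (drop 1 x)))            ≡⟨ cong (λ j → std (drop j (std (drop 1 x)))) (sym (ℕP.m+n∸n≡m d k)) ⟩
    std (drop (d ℕ.+ k ∸ k) (std (drop 1 x))) ∎

theorem6p2 : (k n : ℕ) → 1 ≤ k → k ≤ n → (q₂ : ℚ) → 0ℚ Q.≤ q₂ → q₂ Q.≤ 1ℚ →
    Lumps (perms n) (t2r n) (perms k) (lazy (fromℕ (n ∸ k) * inv n) (t2r k)) (theta n k)
    × Lumps (perms n) (b2r n q₂) (perms k) (b2r k q₂) (theta n k)
theorem6p2 k n 1≤k k≤n q₂ _ _ =
  dynkin⇒lumps (dynkin-t2r n k 1≤k k≤n) (theta-into-perms n k k≤n) (theta-onto-perms n k k≤n) ,
  dynkin⇒lumps dynkin-b2r′ (theta-into-perms n k k≤n) (theta-onto-perms n k k≤n)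
  where
  dynkin-b2r′ : DynkinCriterion (perms n) (b2r n q₂) (perms k) (b2r k q₂) (theta n k)
  dynkin-b2r′ = subst (λ N → DynkinCriterion (perms N) (b2r N q₂) (perms k) (b2r k q₂) (theta N k))
                      (ℕP.m∸n+n≡m k≤n) (dynkin-b2r q₂ (n ∸ k) k)
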